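{- For every positive integer $i$, a graph $G$ is an $(i,1)$ phylogeny graph if and only if $G$ is a diamond-free chordal graph with $\omega(G)\le i+1$ whose clique graph $K(G)$ is a forest.
   Context: All digraphs are finite and simple. For positive integers $i,j$, an $(i,j)$ digraph is an acyclic digraph in which every vertex has indegree at most $i$ and outdegree at most $j$. For an acyclic digraph $D$: $U(D)$ is the simple graph on $V(D)$ with edges $uv$ whenever $(u,v)$ or $(v,u)$ is an arc; $C(D)$ is the simple graph on $V(D)$ with edges $uv$ ($u\ne v$) whenever $u,v$ have a common out-neighbor; the phylogeny graph $P(D)$ has vertex set $V(D)$ and edge set $E(U(D))\cup E(C(D))$. A graph $G$ is an $(i,j)$ phylogeny graph if $G\cong P(D)$ for some $(i,j)$ digraph $D$. A hole is an induced cycle of length at least four; a graph is chordal if it has no hole. A diamond is $K_4$ minus an edge; a graph is diamond-free if it has no induced diamond. $\omega(G)$ is the clique number. The clique graph $K(G)$ has one vertex for each maximal clique of $G$, two being adjacent when the cliques share at least one vertex. -}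

module Defs where

open import Data.Nat using (ℕ; zero; suc; _+_; _≤_)
open import Data.Bool using (Bool; true; false)
open import Data.Fin using (Fin; toℕ; inject₁; fromℕ) renaming (zero to fzero; suc to fsuc)
open import Data.Fin.Subset using (Subset; _∈_; _⊆_; _∩_; Nonempty; ∣_∣)
open import Data.Fin.Permutation using (Permutation′; _⟨$⟩ʳ_)
open import Data.Vec using (tabulate)
open import Data.Product using (Σ; ∃; _×_; _,_)
open import Data.Sum using (_⊎_)
open import Relation.Nullary using (¬_)
open import Relation.Binary.PropositionalEquality using (_≡_; _≢_)
open import Function.Bundles using (_⇔_)
open import Function.Definitions using (Injective)

record Graph (n : ℕ) : Set where
  field
    adj    : Fin n → Fin n → Bool
    sym    : ∀ u v → adj u v ≡ adj v u
    irrefl : ∀ u → adj u u ≡ false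
open Graph public

Adj : ∀ {n} → Graph n → Fin n → Fin n → Set
Adj G u v = adj G u v ≡ true

record Digraph (n : ℕ) : Set where
  field
    arc     : Fin n → Fin n → Bool
    noLoop  : ∀ u → arc u u ≡ false
open Digraph public

Arc : ∀ {n} → Digraph n → Fin n → Fin n → Set
Arc D u v = arc D u v ≡ true

data Reach {n} (D : Digraph n) : Fin n → Fin n → Set where
  step : ∀ {u v} → Arc D u v → Reach D u v
  _∷_  : ∀ {u w v} → Arc D u w → Reach D w v → Reach D u v

Acyclic : ∀ {n} → Digraph n → Set
Acyclic D = ∀ v → ¬ Reach D v v

indeg : ∀ {n} → Digraph n → Fin n → ℕ
indeg D v = ∣ tabulate (λ u → arc D u v) ∣

outdeg : ∀ {n} → Digraph n → Fin n → ℕ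
outdeg D u = ∣ tabulate (λ v → arc D u v) ∣

IJDigraph : ℕ → ℕ → ∀ {n} → Digraph n → Set
IJDigraph i j D = Acyclic D × (∀ v → indeg D v ≤ i) × (∀ v → outdeg D v ≤ j)

-- adjacency in the phylogeny graph P(D): edges of U(D) together with C(D)
PAdj : ∀ {n} → Digraph n → Fin n → Fin n → Set
PAdj D u v = u ≢ v × (Arc D u v ⊎ Arc D v u ⊎ ∃ λ w → Arc D u w × Arc D v w)

-- G ≅ P(D) for some (i,j) digraph D (D may be taken on the vertex set Fin n
-- since isomorphic graphs have the same number of vertices)
IsPhylogenyGraph : ℕ → ℕ → ∀ {n} → Graph n → Set
IsPhylogenyGraph i j {n} G =
  Σ (Digraph n) λ D → IJDigraph i j D ×
    Σ (Permutation′ n) λ σ → ∀ u v → Adj G u v ⇔ PAdj D (σ ⟨$⟩ʳ u) (σ ⟨$⟩ʳ v)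

CycAdj : ℕ → ℕ → ℕ → Set
CycAdj k a b = (suc a ≡ b) ⊎ (suc b ≡ a) ⊎ (a ≡ 0 × suc b ≡ k) ⊎ (b ≡ 0 × suc a ≡ k)

Hole : ∀ {n} → Graph n → Set
Hole {n} G = Σ ℕ λ m → Σ (Fin (4 + m) → Fin n) λ c →
  Injective _≡_ _≡_ c ×
  (∀ a b → Adj G (c a) (c b) ⇔ CycAdj (4 + m) (toℕ a) (toℕ b))

Chordal : ∀ {n} → Graph n → Set
Chordal G = ¬ Hole G

-- Diamonds: K4 minus the edge {0,1}

diamondAdj : Fin 4 → Fin 4 → Bool
diamondAdj fzero fzero = false
diamondAdj fzero (fsuc fzero) = false
diamondAdj (fsuc fzero) fzero = false
diamondAdj (fsuc fzero) (fsuc fzero) = false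
diamondAdj (fsuc (fsuc fzero)) (fsuc (fsuc fzero)) = false
diamondAdj (fsuc (fsuc (fsuc fzero))) (fsuc (fsuc (fsuc fzero))) = false
diamondAdj _ _ = true

InducedDiamond : ∀ {n} → Graph n → Set
InducedDiamond {n} G = Σ (Fin 4 → Fin n) λ f →
  Injective _≡_ _≡_ f × (∀ a b → adj G (f a) (f b) ≡ diamondAdj a b)

DiamondFree : ∀ {n} → Graph n → Set
DiamondFree G = ¬ InducedDiamond G

IsClique : ∀ {n} → Graph n → Subset n → Set
IsClique G S = ∀ u v → u ∈ S → v ∈ S → u ≢ v → Adj G u v

IsMaximalClique : ∀ {n} → Graph n → Subset n → Set
IsMaximalClique G S = IsClique G S × (∀ T → IsClique G T → S ⊆ T → T ⊆ S)

CliqueNumberAtMost : ∀ {n} → Graph n → ℕ → Set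
CliqueNumberAtMost G k = ∀ S → IsClique G S → ∣ S ∣ ≤ k

HasCycle : {V : Set} → (V → Set) → (V → V → Set) → Set
HasCycle {V} P R = Σ ℕ λ m → Σ (Fin (3 + m) → V) λ f →
  (∀ a → P (f a)) × Injective _≡_ _≡_ f ×
  (∀ (a : Fin (2 + m)) → R (f (inject₁ a)) (f (fsuc a))) ×
  R (f (fromℕ (2 + m))) (f fzero)

KAdj : ∀ {n} → Subset n → Subset n → Set
KAdj Q R = Q ≢ R × Nonempty (Q ∩ R)

CliqueGraphIsForest : ∀ {n} → Graph n → Set
CliqueGraphIsForest G = ¬ HasCycle (IsMaximalClique G) KAdj

module Submission where

-- Let D be acyclic with all outdegrees ≤ 1.  The family of z is F(z) = {z} ∪ N⁻(z).
-- P(D) is the union of the complete graphs on the families; two distinct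
-- vertices share at most one family, every triangle of P(D) lies in a family, and
-- a closed walk of pairwise linked families that never backtracks would be a
-- directed cycle (module Families).  Necessity follows: two triangles on a common
-- edge lie in one family (no diamond); cliques lie in families of size
-- 1 + indeg ≤ i + 1; the maximal cliques are exactly the families; and the
-- families along a hole, or along a cycle of K(G), would form a forbidden walk.
--
-- Sufficiency is by induction on the number of non-isolated vertices.  A
-- diamond-free chordal graph with an edge has a simplicial vertex v with a
-- neighbour, and a diamond-free graph whose K(G) is a forest is claw-free.
-- A realisation of G with v isolated extends by one arc at v (module Extension).

open import Defs renaming (sym to adj-sym)
open import Data.Nat using (ℕ; zero; suc; _+_; _∸_; _≤_; _<_; z≤n; s≤s)
open import Data.Nat.Properties
  using (≤-refl; ≤-trans; ≤-reflexive; ≤-pred; <⇒≤; ≤∧≢⇒<; <-irrefl; <-trans; <-cmp; ≤⇒≯; _≤?_;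
         m≤n⇒m<n∨m≡n; m≤n⇒m≤1+n; n<1+n; m≤n+m; m<m+n; n≢0⇒n>0; m+[n∸m]≡n; suc-injective;
         +-assoc; +-comm; +-suc; +-identityʳ; +-mono-≤; +-monoʳ-≤; +-monoʳ-<; +-cancelˡ-≤;
         anyUpTo?; module ≤-Reasoning)
  renaming (_≟_ to _≟ℕ_)
open import Data.Nat.Induction using (<-rec)
open import Data.Bool using (Bool; true; false; _∨_; _∧_; not) renaming (_≟_ to _≟ᵇ_)
open import Data.Bool.Properties using (∨-identityʳ; ∨-zeroʳ; ∧-comm; ∧-identityʳ; ∧-zeroʳ; ¬-not)
open import Data.Fin using (Fin; toℕ; fromℕ<; inject₁; fromℕ; punchIn; punchOut; _≟_)
  renaming (zero to fzero; suc to fsuc)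
open import Data.Fin.Properties
  using (any?; pigeonhole; toℕ<n; toℕ-fromℕ<; toℕ-injective; toℕ-inject₁; toℕ-fromℕ;
         punchIn-punchOut; punchOut-injective; punchInᵢ≢i)
  renaming (suc-injective to fsuc-injective)
open import Data.Fin.Subset using (Subset; _∈_; _⊆_; _∩_; ∣_∣; ⁅_⁆; Nonempty)
open import Data.Fin.Subset.Properties
  using (_∈?_; nonempty?; Empty-unique; ⊆-antisym; x∈p∩q⁻; x∈p∩q⁺; x∈⁅x⁆; x∈⁅y⁆⇒x≡y;
         ∣⊥∣≡0; ∣⁅x⁆∣≡1; p⊆q⇒∣p∣≤∣q∣; p⊂q⇒∣p∣<∣q∣)
open import Data.Fin.Permutation using (Permutation′; _⟨$⟩ʳ_; _⟨$⟩ˡ_; inverseˡ) renaming (id to idₚ)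
open import Data.Vec using (tabulate)
open import Data.Vec.Properties using (lookup∘tabulate; tabulate-cong; []=⇒lookup; lookup⇒[]=)
open import Data.Product using (Σ; ∃; _×_; _,_; proj₁; proj₂)
open import Data.Sum using (_⊎_; inj₁; inj₂)
open import Data.Empty using (⊥; ⊥-elim)
open import Relation.Nullary using (¬_; Dec; yes; no; does)
open import Relation.Nullary.Decidable using (dec-true; dec-false; _⊎-dec_; _×-dec_; ¬?; decidable-stable)
open import Relation.Unary using (Pred; Decidable)
open import Relation.Binary.PropositionalEquality
open import Relation.Binary.Definitions using (tri<; tri≈; tri>)
open import Function using (_∘_; id)
open import Function.Definitions using (Injective)
open import Function.Bundles using (_⇔_; mk⇔; Equivalence)

false≢true : false ≢ true
false≢true ()

from-does : ∀ {p} {P : Set p} (P? : Dec P) → does P? ≡ true → P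
from-does (yes p) _ = p

∈tabulate⁺ : ∀ {n} (f : Fin n → Bool) {x} → f x ≡ true → x ∈ tabulate f
∈tabulate⁺ f {x} fx = lookup⇒[]= x (tabulate f) (trans (lookup∘tabulate f x) fx)

∈tabulate⁻ : ∀ {n} (f : Fin n → Bool) {x} → x ∈ tabulate f → f x ≡ true
∈tabulate⁻ f {x} x∈ = trans (sym (lookup∘tabulate f x)) ([]=⇒lookup x∈)

⟦_⟧ : ∀ {n p} {P : Pred (Fin n) p} → Decidable P → Subset n
⟦ P? ⟧ = tabulate (λ x → does (P? x))

∈⟦⟧⁺ : ∀ {n p} {P : Pred (Fin n) p} (P? : Decidable P) {x} → P x → x ∈ ⟦ P? ⟧
∈⟦⟧⁺ P? {x} px = ∈tabulate⁺ (λ y → does (P? y)) (dec-true (P? x) px)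

∈⟦⟧⁻ : ∀ {n p} {P : Pred (Fin n) p} (P? : Decidable P) {x} → x ∈ ⟦ P? ⟧ → P x
∈⟦⟧⁻ P? {x} x∈ = from-does (P? x) (∈tabulate⁻ (λ y → does (P? y)) x∈)

pair-or-subsingleton : ∀ {n} (S : Subset n) →
  (∃ λ x → ∃ λ y → x ∈ S × y ∈ S × x ≢ y) ⊎ (∀ {x y} → x ∈ S → y ∈ S → x ≡ y)
pair-or-subsingleton S with any? (λ x → any? (λ y → (x ∈? S) ×-dec (y ∈? S) ×-dec ¬? (x ≟ y)))
... | yes (x , y , x∈S , y∈S , x≢y) = inj₁ (x , y , x∈S , y∈S , x≢y)
... | no none =
  inj₂ λ {x} {y} x∈S y∈S → decidable-stable (x ≟ y) (λ x≢y → none (x , y , x∈S , y∈S , x≢y))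

-- Case analysis on whether a vertex is z, without abstracting w ≟ z in the
-- goal (whose arc relation may itself be defined in terms of w ≟ z).
by-cases : ∀ {n p} {P : Fin n → Set p} (z : Fin n) → P z → (∀ w → w ≢ z → P w) → ∀ w → P w
by-cases z pz others w with w ≟ z
... | yes refl = pz
... | no w≢z = others w w≢z

does-≟true : ∀ b → does (b ≟ᵇ true) ≡ b
does-≟true true = refl
does-≟true false = refl

b2n : Bool → ℕ
b2n true = 1
b2n false = 0

count : ∀ {n} → (Fin n → Bool) → ℕ
count {zero} f = 0
count {suc n} f = b2n (f fzero) + count (f ∘ fsuc)

∣tabulate∣≡count : ∀ {n} (f : Fin n → Bool) → ∣ tabulate f ∣ ≡ count f
∣tabulate∣≡count {zero} f = refl
∣tabulate∣≡count {suc n} f with f fzero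
... | true = cong suc (∣tabulate∣≡count (f ∘ fsuc))
... | false = ∣tabulate∣≡count (f ∘ fsuc)

count-cong : ∀ {n} {f g : Fin n → Bool} → (∀ x → f x ≡ g x) → count f ≡ count g
count-cong {zero} h = refl
count-cong {suc n} h = cong₂ _+_ (cong b2n (h fzero)) (count-cong (h ∘ fsuc))

count-punchIn : ∀ {n} (v : Fin (suc n)) (f : Fin (suc n) → Bool) →
  count f ≡ b2n (f v) + count (f ∘ punchIn v)
count-punchIn fzero f = refl
count-punchIn {suc n} (fsuc v) f = begin
  b2n (f fzero) + count (f ∘ fsuc)
    ≡⟨ cong (b2n (f fzero) +_) (count-punchIn v (f ∘ fsuc)) ⟩
  b2n (f fzero) + (b2n (f (fsuc v)) + rest)
    ≡⟨ sym (+-assoc (b2n (f fzero)) _ rest) ⟩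
  b2n (f fzero) + b2n (f (fsuc v)) + rest
    ≡⟨ cong (_+ rest) (+-comm (b2n (f fzero)) _) ⟩
  b2n (f (fsuc v)) + b2n (f fzero) + rest
    ≡⟨ +-assoc (b2n (f (fsuc v))) _ rest ⟩
  b2n (f (fsuc v)) + (b2n (f fzero) + rest) ∎
  where
  open ≡-Reasoning
  rest : ℕ
  rest = count (f ∘ fsuc ∘ punchIn v)

b2n-mono : ∀ {a b} → (a ≡ true → b ≡ true) → b2n a ≤ b2n b
b2n-mono {false} h = z≤n
b2n-mono {true} h rewrite h refl = ≤-refl

b2n≤1 : ∀ b → b2n b ≤ 1
b2n≤1 true = ≤-refl
b2n≤1 false = z≤n

count-injection : ∀ {n m} (f : Fin n → Bool) (g : Fin m → Bool) (h : Fin n → Fin m) →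
  Injective _≡_ _≡_ h → (∀ x → f x ≡ true → g (h x) ≡ true) → count f ≤ count g
count-injection {zero} f g h inj imp = z≤n
count-injection {suc n} {zero} f g h inj imp with h fzero
... | ()
count-injection {suc n} {suc m} f g h inj imp =
  ≤-trans (+-mono-≤ (b2n-mono (imp fzero)) rest) (≤-reflexive (sym (count-punchIn (h fzero) g)))
  where
  h0≢ : ∀ x → h fzero ≢ h (fsuc x)
  h0≢ x eq with inj eq
  ... | ()
  -- h on the remaining points, as a map into the complement of h 0
  h′ : Fin n → Fin m
  h′ x = punchOut (h0≢ x)
  h′-injective : Injective _≡_ _≡_ h′
  h′-injective {x} {y} eq = fsuc-injective (inj (punchOut-injective (h0≢ x) (h0≢ y) eq))
  h′-carries : ∀ x → f (fsuc x) ≡ true → g (punchIn (h fzero) (h′ x)) ≡ true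
  h′-carries x fx rewrite punchIn-punchOut (h0≢ x) = imp (fsuc x) fx
  rest : count (f ∘ fsuc) ≤ count (g ∘ punchIn (h fzero))
  rest = count-injection (f ∘ fsuc) (g ∘ punchIn (h fzero)) h′ h′-injective h′-carries

count-mono : ∀ {n} (f g : Fin n → Bool) → (∀ x → f x ≡ true → g x ≡ true) → count f ≤ count g
count-mono f g = count-injection f g id id

count-zero : ∀ {n} (f : Fin n → Bool) → (∀ x → f x ≡ false) → count f ≡ 0
count-zero {zero} f h = refl
count-zero {suc n} f h rewrite h fzero = count-zero (f ∘ fsuc) (h ∘ fsuc)

1≤count : ∀ {n} (f : Fin n → Bool) a → f a ≡ true → 1 ≤ count f
1≤count {suc n} f a fa rewrite count-punchIn a f | fa = s≤s z≤n

2≤count : ∀ {n} (f : Fin n → Bool) a b → f a ≡ true → f b ≡ true → a ≢ b → 2 ≤ count f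
2≤count {suc n} f a b fa fb a≢b rewrite count-punchIn a f | fa =
  s≤s (1≤count (f ∘ punchIn a) (punchOut a≢b) (trans (cong f (punchIn-punchOut a≢b)) fb))

count-insert : ∀ {n} (g : Fin n → Bool) (v : Fin n) → g v ≡ false →
  count (λ u → does (u ≟ v) ∨ g u) ≡ suc (count g)
count-insert {suc n} g v gv≡false = begin
  count g∪v
    ≡⟨ count-punchIn v g∪v ⟩
  b2n (does (v ≟ v) ∨ g v) + count (g∪v ∘ punchIn v)
    ≡⟨ cong₂ (λ a b → b2n (a ∨ g v) + b) (dec-true (v ≟ v) refl) (count-cong off-v) ⟩
  suc (count (g ∘ punchIn v))
    ≡⟨ cong (λ b → suc (b2n b + count (g ∘ punchIn v))) (sym gv≡false) ⟩
  suc (b2n (g v) + count (g ∘ punchIn v))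
    ≡⟨ cong suc (sym (count-punchIn v g)) ⟩
  suc (count g) ∎
  where
  open ≡-Reasoning
  g∪v : Fin (suc n) → Bool
  g∪v u = does (u ≟ v) ∨ g u
  off-v : ∀ x → g∪v (punchIn v x) ≡ g (punchIn v x)
  off-v x = cong (_∨ g (punchIn v x)) (dec-false (punchIn v x ≟ v) (punchInᵢ≢i v x))

count-∨-point≤ : ∀ {n} (f : Fin n → Bool) (v : Fin n) (g : Fin n → Bool) →
  count (λ u → f u ∨ (does (u ≟ v) ∧ g u)) ≤ suc (count f)
count-∨-point≤ {suc n} f v g = begin
  count f∨v
    ≡⟨ count-punchIn v f∨v ⟩
  b2n (f∨v v) + count (f∨v ∘ punchIn v)
    ≤⟨ +-mono-≤ (b2n≤1 (f∨v v)) (≤-reflexive (count-cong off-v)) ⟩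
  suc (count (f ∘ punchIn v))
    ≤⟨ s≤s (m≤n+m _ (b2n (f v))) ⟩
  suc (b2n (f v) + count (f ∘ punchIn v))
    ≡⟨ cong suc (sym (count-punchIn v f)) ⟩
  suc (count f) ∎
  where
  open ≤-Reasoning
  f∨v : Fin (suc n) → Bool
  f∨v u = f u ∨ (does (u ≟ v) ∧ g u)
  off-v : ∀ x → f∨v (punchIn v x) ≡ f (punchIn v x)
  off-v x rewrite dec-false (punchIn v x ≟ v) (punchInᵢ≢i v x) = ∨-identityʳ (f (punchIn v x))

arc⇒≢ : ∀ {n} (D : Digraph n) {a b} → Arc D a b → a ≢ b
arc⇒≢ D {a} h refl = false≢true (trans (sym (noLoop D a)) h)

Arc? : ∀ {n} (D : Digraph n) a b → Dec (Arc D a b)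
Arc? D a b = arc D a b ≟ᵇ true

PAdj-sym : ∀ {n} (D : Digraph n) {a b} → PAdj D a b → PAdj D b a
PAdj-sym D (a≢b , inj₁ h) = a≢b ∘ sym , inj₂ (inj₁ h)
PAdj-sym D (a≢b , inj₂ (inj₁ h)) = a≢b ∘ sym , inj₁ h
PAdj-sym D (a≢b , inj₂ (inj₂ (w , h , g))) = a≢b ∘ sym , inj₂ (inj₂ (w , g , h))

outdeg≤1⇒functional : ∀ {n} (D : Digraph n) → (∀ v → outdeg D v ≤ 1) →
  ∀ {u w w′} → Arc D u w → Arc D u w′ → w ≡ w′
outdeg≤1⇒functional D outdeg≤1 {u} {w} {w′} h h′ with w ≟ w′
... | yes w≡w′ = w≡w′
... | no w≢w′ with ≤-trans (2≤count (arc D u) w w′ h h′ w≢w′)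
                    (≤-trans (≤-reflexive (sym (∣tabulate∣≡count (arc D u)))) (outdeg≤1 u))
... | s≤s ()

Adj? : ∀ {n} (G : Graph n) u v → Dec (Adj G u v)
Adj? G u v = adj G u v ≟ᵇ true

adj⇒≢ : ∀ {n} (G : Graph n) {x y} → Adj G x y → x ≢ y
adj⇒≢ G {x} h refl = false≢true (trans (sym (irrefl G x)) h)

adj-symm : ∀ {n} (G : Graph n) {x y} → Adj G x y → Adj G y x
adj-symm G {x} {y} h = trans (adj-sym G y x) h

module Families {n} (D : Digraph n) (acyclic : Acyclic D)
  (functional : ∀ {u w w′} → Arc D u w → Arc D u w′ → w ≡ w′) where

  InFamily : Fin n → Fin n → Set
  InFamily z u = u ≡ z ⊎ Arc D u z

  InFamily? : ∀ z → Decidable (InFamily z)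
  InFamily? z u = (u ≟ z) ⊎-dec (arc D u z ≟ᵇ true)

  family-size : ∀ z → count (λ u → does (InFamily? z u)) ≡ suc (indeg D z)
  family-size z = begin
    count (λ u → does (u ≟ z) ∨ does (arc D u z ≟ᵇ true))
      ≡⟨ count-cong (λ u → cong (does (u ≟ z) ∨_) (does-≟true (arc D u z))) ⟩
    count (λ u → does (u ≟ z) ∨ arc D u z)
      ≡⟨ count-insert (λ u → arc D u z) z (noLoop D z) ⟩
    suc (count (λ u → arc D u z))
      ≡⟨ cong suc (sym (∣tabulate∣≡count (λ u → arc D u z))) ⟩
    suc (indeg D z) ∎
    where open ≡-Reasoning

  -- two families are linked when an arc joins their heads
  Linked : Fin n → Fin n → Set
  Linked x y = Arc D x y ⊎ Arc D y x

  no-2-cycle : ∀ {a b} → Arc D a b → Arc D b a → ⊥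
  no-2-cycle {a} h g = acyclic a (h ∷ step g)

  padj⇒family : ∀ {a b} → PAdj D a b → ∃ λ z → InFamily z a × InFamily z b
  padj⇒family {a} {b} (_ , inj₁ h) = b , inj₂ h , inj₁ refl
  padj⇒family {a} {b} (_ , inj₂ (inj₁ h)) = a , inj₁ refl , inj₂ h
  padj⇒family (_ , inj₂ (inj₂ (w , h , g))) = w , inj₂ h , inj₂ g

  family⇒padj : ∀ {z a b} → InFamily z a → InFamily z b → a ≢ b → PAdj D a b
  family⇒padj (inj₁ refl) (inj₁ refl) a≢b = ⊥-elim (a≢b refl)
  family⇒padj (inj₁ refl) (inj₂ h) a≢b = a≢b , inj₂ (inj₁ h)
  family⇒padj (inj₂ h) (inj₁ refl) a≢b = a≢b , inj₁ h
  family⇒padj {z} (inj₂ h) (inj₂ g) a≢b = a≢b , inj₂ (inj₂ (z , h , g))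

  family-unique : ∀ {z z′ a b} → InFamily z a → InFamily z b →
    InFamily z′ a → InFamily z′ b → a ≢ b → z ≡ z′
  family-unique (inj₂ h) _ (inj₂ h′) _ _ = functional h h′
  family-unique (inj₁ refl) _ (inj₁ refl) _ _ = refl
  family-unique (inj₁ refl) (inj₁ refl) (inj₂ _) _ a≢b = ⊥-elim (a≢b refl)
  family-unique (inj₁ refl) (inj₂ g) (inj₂ h′) (inj₁ refl) _ = ⊥-elim (no-2-cycle h′ g)
  family-unique (inj₁ refl) (inj₂ g) (inj₂ h′) (inj₂ g′) _ = ⊥-elim (arc⇒≢ D h′ (functional g g′))
  family-unique (inj₂ _) _ (inj₁ refl) (inj₁ refl) a≢b = ⊥-elim (a≢b refl)
  family-unique (inj₂ h) (inj₁ refl) (inj₁ refl) (inj₂ g′) _ = ⊥-elim (no-2-cycle h g′)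
  family-unique (inj₂ h) (inj₂ g) (inj₁ refl) (inj₂ g′) _ = ⊥-elim (arc⇒≢ D h (sym (functional g g′)))

  shared⇒linked : ∀ {x y u} → InFamily x u → InFamily y u → x ≢ y → Linked x y
  shared⇒linked (inj₁ refl) (inj₁ refl) x≢y = ⊥-elim (x≢y refl)
  shared⇒linked (inj₁ refl) (inj₂ h) _ = inj₁ h
  shared⇒linked (inj₂ h) (inj₁ refl) _ = inj₂ h
  shared⇒linked (inj₂ h) (inj₂ g) x≢y = ⊥-elim (x≢y (functional h g))

  -- Three distinct families are never pairwise linked: the three arcs would
  -- either form a directed cycle or give some vertex two out-neighbours.
  no-linked-triangle : ∀ {x y z} → x ≢ y → y ≢ z → x ≢ z →
    Linked x y → Linked y z → Linked x z → ⊥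
  no-linked-triangle _ y≢z _ (inj₁ xy) _ (inj₁ xz) = y≢z (functional xy xz)
  no-linked-triangle _ _ _ (inj₁ xy) (inj₁ yz) (inj₂ zx) = acyclic _ (xy ∷ (yz ∷ step zx))
  no-linked-triangle x≢y _ _ (inj₁ xy) (inj₂ zy) (inj₂ zx) = x≢y (functional zx zy)
  no-linked-triangle _ _ x≢z (inj₂ yx) (inj₁ yz) _ = x≢z (functional yx yz)
  no-linked-triangle _ _ _ (inj₂ yx) (inj₂ zy) (inj₁ xz) = acyclic _ (xz ∷ (zy ∷ step yx))
  no-linked-triangle x≢y _ _ (inj₂ yx) (inj₂ zy) (inj₂ zx) = x≢y (functional zx zy)

  triangle⇒family : ∀ {a b c} → PAdj D a b → PAdj D a c → PAdj D b c →
    ∃ λ z → InFamily z a × InFamily z b × InFamily z c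
  triangle⇒family ab ac bc with padj⇒family ab | padj⇒family ac | padj⇒family bc
  ... | z₁ , z₁a , z₁b | z₂ , z₂a , z₂c | z₃ , z₃b , z₃c with z₁ ≟ z₂ | z₁ ≟ z₃ | z₂ ≟ z₃
  ... | yes refl | _ | _ = z₁ , z₁a , z₁b , z₂c
  ... | no _ | yes refl | _ = z₁ , z₁a , z₁b , z₃c
  ... | no z₁≢z₂ | no _ | yes refl = ⊥-elim (z₁≢z₂ (family-unique z₁a z₁b z₂a z₃b (proj₁ ab)))
  ... | no z₁≢z₂ | no z₁≢z₃ | no z₂≢z₃ =
    ⊥-elim (no-linked-triangle z₁≢z₂ z₂≢z₃ z₁≢z₃
      (shared⇒linked z₁a z₂a z₁≢z₂) (shared⇒linked z₂c z₃c z₂≢z₃) (shared⇒linked z₁b z₃b z₁≢z₃))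

  -- The out-neighbour of a, if any (b otherwise).
  outNeighbourOr : Fin n → Fin n → Fin n
  outNeighbourOr a b with any? (Arc? D a)
  ... | yes (w , _) = w
  ... | no _ = b

  outNeighbourOr-arc : ∀ {a b w} → Arc D a w → Arc D a (outNeighbourOr a b)
  outNeighbourOr-arc {a} {b} {w} h with any? (Arc? D a)
  ... | yes (_ , h′) = h′
  ... | no none = ⊥-elim (none (w , h))

  familyOf : Fin n → Fin n → Fin n
  familyOf a b with Arc? D b a
  ... | yes _ = a
  ... | no _ = outNeighbourOr a b

  familyOf-contains : ∀ {a b} → PAdj D a b → InFamily (familyOf a b) a × InFamily (familyOf a b) b
  familyOf-contains {a} {b} p with Arc? D b a | p
  ... | yes ba | _ = inj₁ refl , inj₂ ba
  ... | no _ | (_ , inj₁ ab) = inj₂ (outNeighbourOr-arc ab) , inj₁ (functional ab (outNeighbourOr-arc ab))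
  ... | no ¬ba | (_ , inj₂ (inj₁ ba)) = ⊥-elim (¬ba ba)
  ... | no _ | (_ , inj₂ (inj₂ (w , aw , bw))) =
    inj₂ (outNeighbourOr-arc aw) , inj₂ (subst (Arc D b) (functional aw (outNeighbourOr-arc aw)) bw)

  clique⇒family : (P : Fin n → Set) → (∀ a b → P a → P b → a ≢ b → PAdj D a b) →
    ∀ {x y} → P x → P y → x ≢ y → ∀ u → P u → InFamily (familyOf x y) u
  clique⇒family P clique {x} {y} px py x≢y u pu with u ≟ x | u ≟ y
  ... | yes refl | _ = proj₁ (familyOf-contains (clique x y px py x≢y))
  ... | no _ | yes refl = proj₂ (familyOf-contains (clique x y px py x≢y))
  ... | no u≢x | no u≢y
    with triangle⇒family (clique x y px py x≢y) (clique x u px pu (u≢x ∘ sym))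
                         (clique y u py pu (u≢y ∘ sym))
  ... | _ , zx , zy , zu =
    let xy = familyOf-contains (clique x y px py x≢y) in
    subst (λ t → InFamily t u) (family-unique zx zy (proj₁ xy) (proj₂ xy) x≢y) zu

  -- By functionality an upward step
  -- (arc from w j to w (j+1)) can only follow an upward step, so the walk is
  -- entirely upward or entirely downward, and either way a directed cycle.
  module ClosedWalk (w : ℕ → Fin n) (k : ℕ)
    (closes : w k ≡ w 0) (closes₁ : w (suc k) ≡ w 1)
    (linked : ∀ j → j < k → Linked (w j) (w (suc j)))
    (non-backtracking : ∀ j → j < k → w j ≢ w (suc (suc j))) where

    Up : ℕ → Set
    Up j = Arc D (w j) (w (suc j))

    up-back : ∀ j → j < k → Up (suc j) → Up j
    up-back j j<k up with linked j j<k
    ... | inj₁ h = h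
    ... | inj₂ down = ⊥-elim (non-backtracking j j<k (functional down up))

    up-propagates : ∀ {j} → j ≤ k → Up j → ∀ {i} → i ≤ j → Up i
    up-propagates {zero} _ up z≤n = up
    up-propagates {suc j} sj≤k up {i} i≤sj with m≤n⇒m<n∨m≡n i≤sj
    ... | inj₂ refl = up
    ... | inj₁ i<sj = up-propagates (<⇒≤ sj≤k) (up-back j sj≤k up) (≤-pred i<sj)

    upward-reach : (∀ i → i < k → Up i) → ∀ j → j < k → Reach D (w 0) (w (suc j))
    upward-reach ups zero j<k = step (ups 0 j<k)
    upward-reach ups (suc j) j<k = snoc (upward-reach ups j (<⇒≤ j<k)) (ups (suc j) j<k)
      where
      snoc : ∀ {a b c} → Reach D a b → Arc D b c → Reach D a c
      snoc (step h) g = h ∷ step g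
      snoc (h ∷ r) g = h ∷ snoc r g

    downward-reach : (∀ i → i < k → Arc D (w (suc i)) (w i)) → ∀ j → j < k → Reach D (w (suc j)) (w 0)
    downward-reach downs zero j<k = step (downs 0 j<k)
    downward-reach downs (suc j) j<k = downs (suc j) j<k ∷ downward-reach downs j (<⇒≤ j<k)

    impossible : 0 < k → ⊥
    impossible 0<k@(s≤s {n = k′} _) with linked 0 0<k
    ... | inj₁ up₀ = acyclic (w 0) (subst (Reach D (w 0)) closes (upward-reach ups k′ ≤-refl))
      where
      ups : ∀ i → i < k → Up i
      ups i i<k = up-propagates ≤-refl (subst₂ (Arc D) (sym closes) (sym closes₁) up₀) (<⇒≤ i<k)
    ... | inj₂ down₀ = acyclic (w 0) (subst (λ x → Reach D x (w 0)) closes (downward-reach downs k′ ≤-refl))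
      where
      downs : ∀ i → i < k → Arc D (w (suc i)) (w i)
      downs i i<k with linked i i<k
      ... | inj₁ up = ⊥-elim (no-2-cycle (up-propagates (<⇒≤ i<k) up z≤n) down₀)
      ... | inj₂ down = down

next : ℕ → ℕ → ℕ
next L a with suc a ≟ℕ L
... | yes _ = 0
... | no _ = suc a

data NextView (L a : ℕ) : ℕ → Set where
  advance     : suc a < L → NextView L a (suc a)
  wrap-around : suc a ≡ L → NextView L a 0

next-view : ∀ {L a} → a < L → NextView L a (next L a)
next-view {L} {a} a<L with suc a ≟ℕ L
... | yes sa≡L = wrap-around sa≡L
... | no sa≢L = advance (≤∧≢⇒< a<L sa≢L)

next-adjacent : ∀ {L a} → a < L → CycAdj L a (next L a)
next-adjacent {L} {a} a<L with next L a | next-view a<L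
... | _ | advance _ = inj₁ refl
... | _ | wrap-around sa≡L = inj₂ (inj₂ (inj₂ (refl , sa≡L)))

next²-distinct : ∀ {L″ a} → let L = 3 + L″ in a < L → a ≢ next L (next L a)
next²-distinct {L″} {a} a<L eq with next (3 + L″) a | next-view a<L
... | _ | advance sa<L with next (3 + L″) (suc a) | next-view sa<L
next²-distinct _ () | _ | advance _ | _ | advance _
next²-distinct _ () | _ | advance _ | _ | wrap-around refl
next²-distinct {L″} {a} a<L eq | _ | wrap-around refl
  with next (3 + L″) 0 | next-view {3 + L″} {0} (s≤s z≤n)
next²-distinct _ () | _ | wrap-around refl | _ | advance _
next²-distinct _ () | _ | wrap-around refl | _ | wrap-around _

next²-nonadjacent : ∀ {L″ a} → let L = 4 + L″ in a < L → ¬ CycAdj L a (next L (next L a))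
next²-nonadjacent {L″} {a} a<L adj with next (4 + L″) a | next-view a<L
... | _ | advance sa<L with next (4 + L″) (suc a) | next-view sa<L
next²-nonadjacent _ (inj₁ ()) | _ | advance _ | _ | advance _
next²-nonadjacent _ (inj₂ (inj₁ ())) | _ | advance _ | _ | advance _
next²-nonadjacent _ (inj₂ (inj₂ (inj₁ (refl , ())))) | _ | advance _ | _ | advance _
next²-nonadjacent _ (inj₂ (inj₂ (inj₂ (() , _)))) | _ | advance _ | _ | advance _
next²-nonadjacent _ (inj₁ ()) | _ | advance _ | _ | wrap-around refl
next²-nonadjacent _ (inj₂ (inj₁ ())) | _ | advance _ | _ | wrap-around refl
next²-nonadjacent _ (inj₂ (inj₂ (inj₁ (() , _)))) | _ | advance _ | _ | wrap-around refl
next²-nonadjacent _ (inj₂ (inj₂ (inj₂ (refl , ())))) | _ | advance _ | _ | wrap-around refl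
next²-nonadjacent {L″} {a} a<L adj | _ | wrap-around refl
  with next (4 + L″) 0 | next-view {4 + L″} {0} (s≤s z≤n)
next²-nonadjacent _ (inj₁ ()) | _ | wrap-around refl | _ | advance _
next²-nonadjacent _ (inj₂ (inj₁ ())) | _ | wrap-around refl | _ | advance _
next²-nonadjacent _ (inj₂ (inj₂ (inj₁ (() , _)))) | _ | wrap-around refl | _ | advance _
next²-nonadjacent _ (inj₂ (inj₂ (inj₂ (() , _)))) | _ | wrap-around refl | _ | advance _
next²-nonadjacent _ _ | _ | wrap-around refl | _ | wrap-around ()

cyc : ℕ → ℕ → ℕ
cyc L zero = 0
cyc L (suc j) = next L (cyc L j)

cyc<L : ∀ L′ j → cyc (suc L′) j < suc L′
cyc<L L′ zero = s≤s z≤n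
cyc<L L′ (suc j) with next (suc L′) (cyc (suc L′) j) | next-view (cyc<L L′ j)
... | _ | advance lt = lt
... | _ | wrap-around _ = s≤s z≤n

cyc-small : ∀ {L} j → j < L → cyc L j ≡ j
cyc-small zero _ = refl
cyc-small {L} (suc j) sj<L rewrite cyc-small j (<⇒≤ sj<L) with next L j | next-view {L} {j} (<⇒≤ sj<L)
... | _ | advance _ = refl
... | _ | wrap-around refl = ⊥-elim (<-irrefl refl sj<L)

cyc-period : ∀ L′ j → cyc (suc L′) (j + suc L′) ≡ cyc (suc L′) j
cyc-period L′ zero rewrite cyc-small {suc L′} L′ ≤-refl
  with next (suc L′) L′ | next-view {suc L′} {L′} ≤-refl
... | _ | advance sL′<sL′ = ⊥-elim (<-irrefl refl sL′<sL′)
... | _ | wrap-around _ = refl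
cyc-period L′ (suc j) = cong (next (suc L′)) (cyc-period L′ j)

pos : ∀ L′ → ℕ → Fin (suc L′)
pos L′ j = fromℕ< (cyc<L L′ j)

toℕ-pos : ∀ L′ j → toℕ (pos L′ j) ≡ cyc (suc L′) j
toℕ-pos L′ j = toℕ-fromℕ< (cyc<L L′ j)

pos-period : ∀ L′ j → pos L′ (j + suc L′) ≡ pos L′ j
pos-period L′ j =
  toℕ-injective (trans (toℕ-pos L′ (j + suc L′)) (trans (cyc-period L′ j) (sym (toℕ-pos L′ j))))

along-cycle : ∀ {a} {A : Set a} {r} (R : A → A → Set r) {L′} (f : Fin (suc L′) → A) →
  (∀ (t : Fin L′) → R (f (inject₁ t)) (f (fsuc t))) → R (f (fromℕ L′)) (f fzero) →
  ∀ j → R (f (pos L′ j)) (f (pos L′ (suc j)))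
along-cycle R {L′} f steps last j =
  consecutive (pos L′ j) (pos L′ (suc j)) (toℕ-pos L′ j) (toℕ-pos L′ (suc j)) (cyc<L L′ j)
  where
  consecutive : ∀ {a} (p q : Fin (suc L′)) → toℕ p ≡ a → toℕ q ≡ next (suc L′) a → a < suc L′ →
    R (f p) (f q)
  consecutive {a} p q p≡a q≡next a<L with next (suc L′) a | next-view a<L
  ... | _ | advance sa<L = subst₂ (λ x y → R (f x) (f y)) p≡ q≡ (steps t)
    where
    t : Fin L′
    t = fromℕ< (≤-pred sa<L)
    p≡ : inject₁ t ≡ p
    p≡ = toℕ-injective (trans (toℕ-inject₁ t) (trans (toℕ-fromℕ< (≤-pred sa<L)) (sym p≡a)))
    q≡ : fsuc t ≡ q
    q≡ = toℕ-injective (trans (cong suc (toℕ-fromℕ< (≤-pred sa<L))) (sym q≡next))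
  ... | _ | wrap-around sa≡L = subst₂ (λ x y → R (f x) (f y)) p≡ q≡ last
    where
    p≡ : fromℕ L′ ≡ p
    p≡ = toℕ-injective (trans (toℕ-fromℕ L′) (trans (suc-injective (sym sa≡L)) (sym p≡a)))
    q≡ : fzero ≡ q
    q≡ = toℕ-injective (sym q≡next)

module PhylogenyGraphProperties (i : ℕ) {n} (G : Graph n) (D : Digraph n)
  (acyclic : Acyclic D) (indeg≤i : ∀ v → indeg D v ≤ i) (outdeg≤1 : ∀ v → outdeg D v ≤ 1)
  (σ : Permutation′ n) (iso : ∀ u v → Adj G u v ⇔ PAdj D (σ ⟨$⟩ʳ u) (σ ⟨$⟩ʳ v)) where

  open Families D acyclic (outdeg≤1⇒functional D outdeg≤1)

  s : Fin n → Fin n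
  s u = σ ⟨$⟩ʳ u

  s-injective : Injective _≡_ _≡_ s
  s-injective {x} {y} e = trans (sym (inverseˡ σ)) (trans (cong (σ ⟨$⟩ˡ_) e) (inverseˡ σ))

  toP : ∀ {x y} → Adj G x y → PAdj D (s x) (s y)
  toP {x} {y} = Equivalence.to (iso x y)

  fromP : ∀ {x y} → PAdj D (s x) (s y) → Adj G x y
  fromP {x} {y} = Equivalence.from (iso x y)

  family⇒adj : ∀ {z x y} → InFamily z (s x) → InFamily z (s y) → x ≢ y → Adj G x y
  family⇒adj zx zy x≢y = fromP (family⇒padj zx zy (x≢y ∘ s-injective))

  -- Two triangles of G on a common edge cd lie in one family (the family of
  -- c and d), so their apexes a and b are adjacent.
  common-edge : ∀ {a b c d} → Adj G c d → Adj G c a → Adj G d a → Adj G c b → Adj G d b → a ≢ b → Adj G a b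
  common-edge cd ca da cb db a≢b
    with triangle⇒family (toP cd) (toP ca) (toP da) | triangle⇒family (toP cd) (toP cb) (toP db)
  ... | z , zc , zd , za | z′ , z′c , z′d , z′b with family-unique zc zd z′c z′d (proj₁ (toP cd))
  ... | refl = family⇒adj za z′b a≢b

  -- In a diamond the apexes 0 and 1 share the edge 23, so they would be adjacent.
  diamond-free : DiamondFree G
  diamond-free (f , f-injective , f-adj) =
    false≢true (trans (sym (f-adj 0F 1F))
      (common-edge (f-adj 2F 3F) (f-adj 2F 0F) (f-adj 3F 0F) (f-adj 2F 1F) (f-adj 3F 1F)
        (λ e → 0≢1 (f-injective e))))
    where
    0F 1F 2F 3F : Fin 4
    0F = fzero
    1F = fsuc fzero
    2F = fsuc (fsuc fzero)
    3F = fsuc (fsuc (fsuc fzero))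
    0≢1 : 0F ≢ 1F
    0≢1 ()

  -- Holes: around a hole of length L = 4 + m, the families w j of consecutive
  -- edges form a closed walk; consecutive ones are linked (they share a vertex
  -- and are distinct), and the walk never backtracks, since a family holding
  -- the vertices j and j+2 of the hole would be a chord.
  chordal : Chordal G
  chordal (m , c , c-injective , c-adj) =
    ClosedWalk.impossible w L closes closes₁ linked non-backtracking (s≤s z≤n)
    where
    L′ L : ℕ
    L′ = 3 + m
    L = 4 + m
    y : ℕ → Fin n
    y j = c (pos L′ j)
    x : ℕ → Fin n
    x j = s (y j)
    consecutive : ∀ j → Adj G (y j) (y (suc j))
    consecutive j = Equivalence.from (c-adj _ _)
      (subst₂ (CycAdj L) (sym (toℕ-pos L′ j)) (sym (toℕ-pos L′ (suc j))) (next-adjacent (cyc<L L′ j)))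
    two-apart-distinct : ∀ j → y j ≢ y (2 + j)
    two-apart-distinct j e = next²-distinct {1 + m} (cyc<L L′ j)
      (trans (sym (toℕ-pos L′ j)) (trans (cong toℕ (c-injective e)) (toℕ-pos L′ (2 + j))))
    two-apart : ∀ j {z} → InFamily z (x j) → InFamily z (x (2 + j)) → ⊥
    two-apart j zx zx₂ = next²-nonadjacent {m} (cyc<L L′ j)
      (subst₂ (CycAdj L) (toℕ-pos L′ j) (toℕ-pos L′ (2 + j))
        (Equivalence.to (c-adj _ _) (family⇒adj zx zx₂ (two-apart-distinct j))))
    w : ℕ → Fin n
    w j = familyOf (x j) (x (suc j))
    w-contains : ∀ j → InFamily (w j) (x j) × InFamily (w j) (x (suc j))
    w-contains j = familyOf-contains (toP (consecutive j))
    linked : ∀ j → j < L → Linked (w j) (w (suc j))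
    linked j _ = shared⇒linked (proj₂ (w-contains j)) (proj₁ (w-contains (suc j)))
      (λ e → two-apart j (proj₁ (w-contains j))
               (subst (λ z → InFamily z (x (2 + j))) (sym e) (proj₂ (w-contains (suc j)))))
    non-backtracking : ∀ j → j < L → w j ≢ w (2 + j)
    non-backtracking j _ e =
      two-apart j (proj₁ (w-contains j))
        (subst (λ z → InFamily z (x (2 + j))) (sym e) (proj₁ (w-contains (2 + j))))
    closes : w L ≡ w 0
    closes = cong₂ familyOf (cong (s ∘ c) (pos-period L′ 0)) (cong (s ∘ c) (pos-period L′ 1))
    closes₁ : w (suc L) ≡ w 1
    closes₁ = cong₂ familyOf (cong (s ∘ c) (pos-period L′ 1)) (cong (s ∘ c) (pos-period L′ 2))

  familySet : Fin n → Subset n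
  familySet z = ⟦ (λ u → InFamily? z (s u)) ⟧

  ∈familySet⁺ : ∀ {z u} → InFamily z (s u) → u ∈ familySet z
  ∈familySet⁺ {z} = ∈⟦⟧⁺ (λ u → InFamily? z (s u))

  ∈familySet⁻ : ∀ {z u} → u ∈ familySet z → InFamily z (s u)
  ∈familySet⁻ {z} = ∈⟦⟧⁻ (λ u → InFamily? z (s u))

  familySet-clique : ∀ z → IsClique G (familySet z)
  familySet-clique z u v u∈ v∈ u≢v = family⇒adj (∈familySet⁻ u∈) (∈familySet⁻ v∈) u≢v

  ∣familySet∣≤1+i : ∀ z → ∣ familySet z ∣ ≤ suc i
  ∣familySet∣≤1+i z = begin
    ∣ familySet z ∣                          ≡⟨ ∣tabulate∣≡count (λ u → does (InFamily? z (s u))) ⟩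
    count (λ u → does (InFamily? z (s u)))  ≤⟨ count-injection _ _ s s-injective (λ _ h → h) ⟩
    count (λ t → does (InFamily? z t))      ≡⟨ family-size z ⟩
    suc (indeg D z)                         ≤⟨ s≤s (indeg≤i z) ⟩
    suc i                                   ∎
    where open ≤-Reasoning

  clique⊆family : ∀ {S} → IsClique G S → Nonempty S → ∃ λ z → S ⊆ familySet z
  clique⊆family {S} clique (x , x∈S) with pair-or-subsingleton S
  ... | inj₁ (a , b , a∈S , b∈S , a≢b) =
    familyOf (s a) (s b) , λ {u} u∈S → ∈familySet⁺
      (clique⇒family Image image-clique (a , a∈S , refl) (b , b∈S , refl) (a≢b ∘ s-injective)
        (s u) (u , u∈S , refl))
    where
    Image : Fin n → Set
    Image t = ∃ λ u → u ∈ S × s u ≡ t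
    image-clique : ∀ t t′ → Image t → Image t′ → t ≢ t′ → PAdj D t t′
    image-clique _ _ (u , u∈S , refl) (v , v∈S , refl) su≢sv = toP (clique u v u∈S v∈S (su≢sv ∘ cong s))
  ... | inj₂ single = s x , λ {u} u∈S → ∈familySet⁺ (inj₁ (cong s (single u∈S x∈S)))

  clique-number : CliqueNumberAtMost G (suc i)
  clique-number S clique with nonempty? S
  ... | no empty = subst (_≤ suc i) (sym (trans (cong ∣_∣ (Empty-unique empty)) (∣⊥∣≡0 n))) z≤n
  ... | yes nonempty with clique⊆family clique nonempty
  ...   | z , S⊆ = ≤-trans (p⊆q⇒∣p∣≤∣q∣ S⊆) (∣familySet∣≤1+i z)

  maximal-nonempty : ∀ {Q} → Fin n → IsMaximalClique G Q → Nonempty Q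
  maximal-nonempty {Q} v (_ , maximal) with nonempty? Q
  ... | yes nonempty = nonempty
  ... | no empty = v , maximal ⁅ v ⁆ singleton-clique (λ u∈Q → ⊥-elim (empty (_ , u∈Q))) (x∈⁅x⁆ v)
    where
    singleton-clique : IsClique G ⁅ v ⁆
    singleton-clique a b a∈ b∈ a≢b = ⊥-elim (a≢b (trans (x∈⁅y⁆⇒x≡y v a∈) (sym (x∈⁅y⁆⇒x≡y v b∈))))

  maximal⇒family : ∀ {Q} → IsMaximalClique G Q → Nonempty Q → ∃ λ z → Q ≡ familySet z
  maximal⇒family (clique , maximal) nonempty with clique⊆family clique nonempty
  ... | z , Q⊆ = z , ⊆-antisym Q⊆ (maximal _ (familySet-clique z) Q⊆)

  -- Cycles of K(G): the families of consecutive maximal cliques share a vertex,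
  -- so they are linked, and an injective cycle never backtracks.
  clique-graph-forest : CliqueGraphIsForest G
  clique-graph-forest (m , f , f-maximal , f-injective , steps , last) =
    ClosedWalk.impossible w L closes closes₁ linked non-backtracking (s≤s z≤n)
    where
    L′ L : ℕ
    L′ = 2 + m
    L = 3 + m
    v₀ : Fin n
    v₀ = proj₁ (proj₂ last)
    head : Fin L → Fin n
    head a = proj₁ (maximal⇒family (f-maximal a) (maximal-nonempty v₀ (f-maximal a)))
    head-spec : ∀ a → f a ≡ familySet (head a)
    head-spec a = proj₂ (maximal⇒family (f-maximal a) (maximal-nonempty v₀ (f-maximal a)))
    head-injective : ∀ {a b} → head a ≡ head b → a ≡ b
    head-injective {a} {b} e = f-injective (trans (head-spec a) (trans (cong familySet e) (sym (head-spec b))))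
    w : ℕ → Fin n
    w j = head (pos L′ j)
    linked : ∀ j → j < L → Linked (w j) (w (suc j))
    linked j _ with along-cycle KAdj f steps last j
    ... | f≢f′ , u , u∈∩ with x∈p∩q⁻ _ _ u∈∩
    ...   | u∈Q , u∈R =
      shared⇒linked (∈familySet⁻ (subst (u ∈_) (head-spec _) u∈Q)) (∈familySet⁻ (subst (u ∈_) (head-spec _) u∈R))
        (λ e → f≢f′ (cong f (head-injective e)))
    non-backtracking : ∀ j → j < L → w j ≢ w (2 + j)
    non-backtracking j _ e = next²-distinct {m} (cyc<L L′ j)
      (trans (sym (toℕ-pos L′ j)) (trans (cong toℕ (head-injective e)) (toℕ-pos L′ (2 + j))))
    closes : w L ≡ w 0
    closes = cong head (pos-period L′ 0)
    closes₁ : w (suc L) ≡ w 1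
    closes₁ = cong head (pos-period L′ 1)

diamond : ∀ {n} (G : Graph n) {a b c d} → a ≢ b → ¬ Adj G a b → Adj G c d →
  Adj G a c → Adj G a d → Adj G b c → Adj G b d → InducedDiamond G
diamond {n} G {a} {b} {c} {d} a≢b ¬ab cd ac ad bc bd = f , f-injective , f-adj
  where
  f : Fin 4 → Fin n
  f fzero = a
  f (fsuc fzero) = b
  f (fsuc (fsuc fzero)) = c
  f (fsuc (fsuc (fsuc fzero))) = d
  f-adj : ∀ x y → adj G (f x) (f y) ≡ diamondAdj x y
  f-adj fzero fzero = irrefl G a
  f-adj fzero (fsuc fzero) = ¬-not ¬ab
  f-adj fzero (fsuc (fsuc fzero)) = ac
  f-adj fzero (fsuc (fsuc (fsuc fzero))) = ad
  f-adj (fsuc fzero) fzero = ¬-not (¬ab ∘ adj-symm G)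
  f-adj (fsuc fzero) (fsuc fzero) = irrefl G b
  f-adj (fsuc fzero) (fsuc (fsuc fzero)) = bc
  f-adj (fsuc fzero) (fsuc (fsuc (fsuc fzero))) = bd
  f-adj (fsuc (fsuc fzero)) fzero = adj-symm G ac
  f-adj (fsuc (fsuc fzero)) (fsuc fzero) = adj-symm G bc
  f-adj (fsuc (fsuc fzero)) (fsuc (fsuc fzero)) = irrefl G c
  f-adj (fsuc (fsuc fzero)) (fsuc (fsuc (fsuc fzero))) = cd
  f-adj (fsuc (fsuc (fsuc fzero))) fzero = adj-symm G ad
  f-adj (fsuc (fsuc (fsuc fzero))) (fsuc fzero) = adj-symm G bd
  f-adj (fsuc (fsuc (fsuc fzero))) (fsuc (fsuc fzero)) = adj-symm G cd
  f-adj (fsuc (fsuc (fsuc fzero))) (fsuc (fsuc (fsuc fzero))) = irrefl G d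
  non-edge : ∀ x y → diamondAdj x y ≡ false → f x ≡ f y → x ≡ y
  non-edge fzero fzero _ _ = refl
  non-edge fzero (fsuc fzero) _ e = ⊥-elim (a≢b e)
  non-edge (fsuc fzero) fzero _ e = ⊥-elim (a≢b (sym e))
  non-edge (fsuc fzero) (fsuc fzero) _ _ = refl
  non-edge (fsuc (fsuc fzero)) (fsuc (fsuc fzero)) _ _ = refl
  non-edge (fsuc (fsuc (fsuc fzero))) (fsuc (fsuc (fsuc fzero))) _ _ = refl
  non-edge fzero (fsuc (fsuc fzero)) () _
  non-edge fzero (fsuc (fsuc (fsuc fzero))) () _
  non-edge (fsuc fzero) (fsuc (fsuc fzero)) () _
  non-edge (fsuc fzero) (fsuc (fsuc (fsuc fzero))) () _
  non-edge (fsuc (fsuc fzero)) fzero () _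
  non-edge (fsuc (fsuc fzero)) (fsuc fzero) () _
  non-edge (fsuc (fsuc fzero)) (fsuc (fsuc (fsuc fzero))) () _
  non-edge (fsuc (fsuc (fsuc fzero))) fzero () _
  non-edge (fsuc (fsuc (fsuc fzero))) (fsuc fzero) () _
  non-edge (fsuc (fsuc (fsuc fzero))) (fsuc (fsuc fzero)) () _
  f-injective : Injective _≡_ _≡_ f
  f-injective {x} {y} e =
    non-edge x y (trans (sym (f-adj x y)) (trans (cong (λ t → adj G t (f y)) e) (irrefl G (f y)))) e

CycAdj-sym : ∀ {k a b} → CycAdj k a b → CycAdj k b a
CycAdj-sym (inj₁ e) = inj₂ (inj₁ e)
CycAdj-sym (inj₂ (inj₁ e)) = inj₁ e
CycAdj-sym (inj₂ (inj₂ (inj₁ e))) = inj₂ (inj₂ (inj₂ e))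
CycAdj-sym (inj₂ (inj₂ (inj₂ e))) = inj₂ (inj₂ (inj₁ e))

induced-cycle⇒hole : ∀ {n} (G : Graph n) (q : ℕ → Fin n) (m : ℕ) →
  (∀ a → Adj G (q a) (q (suc a))) → Adj G (q 0) (q (3 + m)) →
  (∀ a b → 2 + a ≤ b → b ≤ 3 + m → ¬ (a ≡ 0 × b ≡ 3 + m) → q a ≢ q b × ¬ Adj G (q a) (q b)) →
  Hole G
induced-cycle⇒hole G q m path closing induced =
  m , (λ t → q (toℕ t)) , (λ {t} {t′} e → toℕ-injective (proj₂ (relation (bound t) (bound t′)) e)) ,
  λ t t′ → mk⇔ (proj₁ (relation (bound t) (bound t′))) (cycAdj⇒adj (toℕ t) (toℕ t′))
  where
  bound : (t : Fin (4 + m)) → toℕ t ≤ 3 + m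
  bound t = ≤-pred (toℕ<n t)

  ordered : ∀ {a b} → a < b → b ≤ 3 + m → (Adj G (q a) (q b) → CycAdj (4 + m) a b) × q a ≢ q b
  ordered {a} {b} a<b b≤ with m≤n⇒m<n∨m≡n a<b
  ... | inj₂ refl = (λ _ → inj₁ refl) , adj⇒≢ G (path a)
  ... | inj₁ 2+a≤b with a ≟ℕ 0 | b ≟ℕ (3 + m)
  ...   | yes refl | yes refl = (λ _ → inj₂ (inj₂ (inj₁ (refl , refl)))) , adj⇒≢ G closing
  ...   | yes refl | no b≢ = (λ h → ⊥-elim (proj₂ far h)) , proj₁ far
    where
    far : q 0 ≢ q b × ¬ Adj G (q 0) (q b)
    far = induced 0 b 2+a≤b b≤ (b≢ ∘ proj₂)
  ...   | no a≢0 | _ = (λ h → ⊥-elim (proj₂ far h)) , proj₁ far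
    where
    far : q a ≢ q b × ¬ Adj G (q a) (q b)
    far = induced a b 2+a≤b b≤ (a≢0 ∘ proj₁)

  relation : ∀ {a b} → a ≤ 3 + m → b ≤ 3 + m → (Adj G (q a) (q b) → CycAdj (4 + m) a b) × (q a ≡ q b → a ≡ b)
  relation {a} {b} a≤ b≤ with <-cmp a b
  ... | tri< a<b _ _ = proj₁ (ordered a<b b≤) , λ e → ⊥-elim (proj₂ (ordered a<b b≤) e)
  ... | tri≈ _ refl _ = (λ h → ⊥-elim (adj⇒≢ G h refl)) , λ _ → refl
  ... | tri> _ _ b<a =
    (λ h → CycAdj-sym (proj₁ (ordered b<a a≤) (adj-symm G h))) , λ e → ⊥-elim (proj₂ (ordered b<a a≤) (sym e))

  cycAdj⇒adj : ∀ a b → CycAdj (4 + m) a b → Adj G (q a) (q b)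
  cycAdj⇒adj a _ (inj₁ refl) = path a
  cycAdj⇒adj _ b (inj₂ (inj₁ refl)) = adj-symm G (path b)
  cycAdj⇒adj _ _ (inj₂ (inj₂ (inj₁ (refl , refl)))) = closing
  cycAdj⇒adj _ _ (inj₂ (inj₂ (inj₂ (refl , refl)))) = adj-symm G closing

first-return⇒hole : ∀ {n} (G : Graph n) (q : ℕ → Fin n) (d : ℕ) →
  (∀ a → Adj G (q a) (q (suc a))) →
  (∀ a → q a ≢ q (2 + a) × ¬ Adj G (q a) (q (2 + a))) →
  q 0 ≡ q d ⊎ Adj G (q 0) (q d) → 2 ≤ d →
  (∀ a b → 2 + a ≤ b → b ≤ d → ¬ (a ≡ 0 × b ≡ d) → q a ≢ q b × ¬ Adj G (q a) (q b)) →
  Hole G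
first-return⇒hole G q 1 _ _ _ (s≤s ()) _
first-return⇒hole G q 2 path apart (inj₁ e) _ _ = ⊥-elim (proj₁ (apart 0) e)
first-return⇒hole G q 2 path apart (inj₂ h) _ _ = ⊥-elim (proj₂ (apart 0) h)
first-return⇒hole G q 3 path apart (inj₁ e) _ _ =
  ⊥-elim (proj₂ (apart 0) (adj-symm G (subst (Adj G (q 2)) (sym e) (path 2))))
first-return⇒hole G q (suc (suc (suc m))) path apart (inj₂ h) _ first = induced-cycle⇒hole G q m path h first
first-return⇒hole G q (suc (suc (suc (suc m)))) path apart (inj₁ e) _ first =
  induced-cycle⇒hole G q m path closing induced
  where
  closing : Adj G (q 0) (q (3 + m))
  closing = adj-symm G (subst (Adj G (q (3 + m))) (sym e) (path (3 + m)))
  induced : ∀ a b → 2 + a ≤ b → b ≤ 3 + m → ¬ (a ≡ 0 × b ≡ 3 + m) → q a ≢ q b × ¬ Adj G (q a) (q b)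
  induced a b 2+a≤b b≤ _ = first a b 2+a≤b (m≤n⇒m≤1+n b≤) (λ { (_ , refl) → <-irrefl refl b≤ })

least : ∀ {p} {P : Pred ℕ p} → Decidable P → ∀ {k} → P k → ∃ λ j → P j × (∀ {i} → i < j → ¬ P i)
least {P = P} P? {k} = <-rec (λ k → P k → ∃ λ j → P j × (∀ {i} → i < j → ¬ P i)) below k
  where
  below : ∀ k → (∀ {i} → i < k → P i → ∃ λ j → P j × (∀ {i} → i < j → ¬ P i)) →
    P k → ∃ λ j → P j × (∀ {i} → i < j → ¬ P i)
  below k smaller pk with anyUpTo? P? k
  ... | yes (i , i<k , pi) = smaller i<k pi
  ... | no none = k , pk , λ {i} i<k pi → none (i , i<k , pi)

greatest : ∀ {p} {P : Pred ℕ p} → Decidable P → ∀ {K l} → l ≤ K → P l →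
  ∃ λ g → g ≤ K × P g × (∀ {l′} → g < l′ → l′ ≤ K → ¬ P l′)
greatest P? {K} l≤K pl with P? K
... | yes pK = K , ≤-refl , pK , λ K<l′ l′≤K → ⊥-elim (≤⇒≯ l′≤K K<l′)
greatest P? {zero} z≤n pl | no ¬pK = ⊥-elim (¬pK pl)
greatest {P = P} P? {suc K} l≤sK pl | no ¬psK with m≤n⇒m<n∨m≡n l≤sK
... | inj₂ refl = ⊥-elim (¬psK pl)
... | inj₁ l<sK with greatest P? (≤-pred l<sK) pl
...   | g , g≤K , pg , above = g , m≤n⇒m≤1+n g≤K , pg , beyond
  where
  beyond : ∀ {l′} → g < l′ → l′ ≤ suc K → ¬ P l′
  beyond g<l′ l′≤sK with m≤n⇒m<n∨m≡n l′≤sK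
  ... | inj₁ l′<sK = above g<l′ (≤-pred l′<sK)
  ... | inj₂ refl = ¬psK

Simplicial : ∀ {n} → Graph n → Fin n → Set
Simplicial G v = ∀ a b → Adj G v a → Adj G v b → a ≢ b → Adj G a b

NonSimplicial : ∀ {n} → Graph n → Fin n → Set
NonSimplicial G v = ∃ λ a → ∃ λ b → Adj G v a × Adj G v b × a ≢ b × ¬ Adj G a b

simplicial-or-not : ∀ {n} (G : Graph n) v → Simplicial G v ⊎ NonSimplicial G v
simplicial-or-not G v
  with any? (λ a → any? (λ b → Adj? G v a ×-dec Adj? G v b ×-dec ¬? (a ≟ b) ×-dec ¬? (Adj? G a b)))
... | yes witness = inj₂ witness
... | no none =
  inj₁ λ a b va vb a≢b → decidable-stable (Adj? G a b) (λ ¬ab → none (a , b , va , vb , a≢b , ¬ab))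

Simplicial? : ∀ {n} (G : Graph n) v → Dec (Simplicial G v)
Simplicial? G v with simplicial-or-not G v
... | inj₁ simplicial = yes simplicial
... | inj₂ (a , b , va , vb , a≢b , ¬ab) = no λ simplicial → ¬ab (simplicial a b va vb a≢b)

-- In a diamond-free graph in which no vertex with a neighbour is simplicial,
-- every edge u₀v₀ starts an infinite walk whose vertices two apart are
-- distinct and non-adjacent: the last vertex v has two non-adjacent
-- neighbours, and diamond-freeness forbids the previous vertex u to be adjacent
-- to both.  By the pigeonhole principle the walk comes back near an earlier
-- vertex; the first such return, taken to the latest possible earlier vertex,
-- closes a hole.
module NoSimplicialVertex {n} (G : Graph n) (diamond-free : DiamondFree G)
  (non-simplicial : ∀ v u → Adj G v u → NonSimplicial G v)
  {u₀ v₀ : Fin n} (u₀v₀ : Adj G u₀ v₀) where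

  extend : ∀ {u v} → Adj G u v → ∃ λ w → Adj G v w × (u ≢ w × ¬ Adj G u w)
  extend {u} {v} uv with non-simplicial v u (adj-symm G uv)
  ... | a , b , va , vb , a≢b , ¬ab with u ≟ a | u ≟ b | Adj? G u a | Adj? G u b
  ...   | yes refl | _ | _ | _ = b , vb , a≢b , ¬ab
  ...   | no _ | yes refl | _ | _ = a , va , a≢b ∘ sym , ¬ab ∘ adj-symm G
  ...   | no u≢a | no _ | no ¬ua | _ = a , va , u≢a , ¬ua
  ...   | no _ | no u≢b | yes _ | no ¬ub = b , vb , u≢b , ¬ub
  ...   | no _ | no _ | yes ua | yes ub =
    ⊥-elim (diamond-free (diamond G a≢b ¬ab uv (adj-symm G ua) (adj-symm G va) (adj-symm G ub) (adj-symm G vb)))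

  Edge : Set
  Edge = Σ (Fin n × Fin n) λ e → Adj G (proj₁ e) (proj₂ e)

  step-forward : Edge → Edge
  step-forward ((u , v) , uv) = (v , proj₁ (extend uv)) , proj₁ (proj₂ (extend uv))

  walk : ℕ → Edge
  walk zero = (u₀ , v₀) , u₀v₀
  walk (suc k) = step-forward (walk k)

  p : ℕ → Fin n
  p k = proj₁ (proj₁ (walk k))

  p-adj : ∀ k → Adj G (p k) (p (suc k))
  p-adj k = proj₂ (walk k)

  p-apart : ∀ k → p k ≢ p (2 + k) × ¬ Adj G (p k) (p (2 + k))
  p-apart k = proj₂ (proj₂ (extend (proj₂ (walk k))))

  Near : ℕ → ℕ → Set
  Near a b = p a ≡ p b ⊎ Adj G (p a) (p b)

  Near? : ∀ a b → Dec (Near a b)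
  Near? a b = (p a ≟ p b) ⊎-dec Adj? G (p a) (p b)

  BackTo : ℕ → ℕ → Set
  BackTo j l = 2 + l ≤ j × Near l j

  BackTo? : ∀ j l → Dec (BackTo j l)
  BackTo? j l = (2 + l ≤? j) ×-dec Near? l j

  ReturnsAt : ℕ → Set
  ReturnsAt j = ∃ λ l → l < j × BackTo j l

  returns : ∃ ReturnsAt
  returns with pigeonhole ≤-refl (λ t → p (toℕ t))
  ... | a , b , a<b , pa≡pb = toℕ b , toℕ a , a<b , ≤∧≢⇒< a<b sa≢b , inj₁ pa≡pb
    where
    sa≢b : suc (toℕ a) ≢ toℕ b
    sa≢b e = adj⇒≢ G (p-adj (toℕ a)) (trans pa≡pb (cong p (sym e)))

  -- Between the last vertex l that the first return j₀ comes back to and j₀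
  -- itself, the shifted walk q a = p (l + a) makes a first return at d = j₀ - l.
  module Window {j₀ l : ℕ} (l≤j₀ : l ≤ j₀) (back : BackTo j₀ l)
    (first : ∀ {i} → i < j₀ → ¬ ReturnsAt i)
    (last : ∀ {l′} → l < l′ → l′ ≤ j₀ → ¬ BackTo j₀ l′) where

    d : ℕ
    d = j₀ ∸ l

    l+d≡j₀ : l + d ≡ j₀
    l+d≡j₀ = m+[n∸m]≡n l≤j₀

    q : ℕ → Fin n
    q a = p (l + a)

    shift₂ : ∀ a → l + (2 + a) ≡ 2 + (l + a)
    shift₂ a = trans (+-suc l (suc a)) (cong suc (+-suc l a))

    q-adj : ∀ a → Adj G (q a) (q (suc a))
    q-adj a = subst (λ t → Adj G (q a) (p t)) (sym (+-suc l a)) (p-adj (l + a))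

    q-apart : ∀ a → q a ≢ q (2 + a) × ¬ Adj G (q a) (q (2 + a))
    q-apart a = subst (λ t → p (l + a) ≢ p t × ¬ Adj G (p (l + a)) (p t)) (sym (shift₂ a)) (p-apart (l + a))

    q-returns : q 0 ≡ q d ⊎ Adj G (q 0) (q d)
    q-returns = subst₂ Near (sym (+-identityʳ l)) (sym l+d≡j₀) (proj₂ back)

    2≤d : 2 ≤ d
    2≤d = +-cancelˡ-≤ l 2 d (subst₂ _≤_ (+-comm 2 l) (sym l+d≡j₀) (proj₁ back))

    -- pairs ending before j₀ are excluded by the minimality of j₀, pairs
    -- ending at j₀ by the maximality of l
    far : ∀ a b → 2 + a ≤ b → b ≤ d → ¬ (a ≡ 0 × b ≡ d) → ¬ Near (l + a) (l + b)
    far a b 2+a≤b b≤d not-ends with m≤n⇒m<n∨m≡n b≤d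
    ... | inj₁ b<d = λ near → first (subst (l + b <_) l+d≡j₀ (+-monoʳ-< l b<d))
                                    (l + a , +-monoʳ-< l (<-trans (n<1+n a) 2+a≤b) , 2+la≤lb , near)
      where
      2+la≤lb : 2 + (l + a) ≤ l + b
      2+la≤lb = subst (_≤ l + b) (shift₂ a) (+-monoʳ-≤ l 2+a≤b)
    ... | inj₂ refl = λ near → last (m<m+n l (n≢0⇒n>0 (λ a≡0 → not-ends (a≡0 , refl))))
                                   (≤-trans (m≤n+m (l + a) 2) 2+la≤j₀)
                                   (2+la≤j₀ , subst (Near (l + a)) l+d≡j₀ near)
      where
      2+la≤j₀ : 2 + (l + a) ≤ j₀
      2+la≤j₀ = subst₂ _≤_ (shift₂ a) l+d≡j₀ (+-monoʳ-≤ l 2+a≤b)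

    q-first : ∀ a b → 2 + a ≤ b → b ≤ d → ¬ (a ≡ 0 × b ≡ d) → q a ≢ q b × ¬ Adj G (q a) (q b)
    q-first a b 2+a≤b b≤d not-ends =
      (λ e → far a b 2+a≤b b≤d not-ends (inj₁ e)) , (λ h → far a b 2+a≤b b≤d not-ends (inj₂ h))

    hole : Hole G
    hole = first-return⇒hole G q d q-adj q-apart q-returns 2≤d q-first

  hole : Hole G
  hole with least (λ j → anyUpTo? (BackTo? j) j) (proj₂ returns)
  ... | j₀ , (l₀ , l₀<j₀ , back₀) , first with greatest (BackTo? j₀) (<⇒≤ l₀<j₀) back₀
  ...   | l , l≤j₀ , back , last = Window.hole l≤j₀ back first last

simplicial-vertex : ∀ {n} (G : Graph n) → DiamondFree G → Chordal G → ∀ {a b} → Adj G a b →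
  ∃ λ v → Simplicial G v × ∃ (Adj G v)
simplicial-vertex G diamond-free chordal ab with any? (λ v → Simplicial? G v ×-dec any? (Adj? G v))
... | yes found = found
... | no none = ⊥-elim (chordal (NoSimplicialVertex.hole G diamond-free non-simplicial ab))
  where
  non-simplicial : ∀ v u → Adj G v u → NonSimplicial G v
  non-simplicial v u vu with simplicial-or-not G v
  ... | inj₁ simplicial = ⊥-elim (none (v , simplicial , u , vu))
  ... | inj₂ witness = witness

ClawFree : ∀ {n} → Graph n → Set
ClawFree G = ∀ z a b c → Adj G z a → Adj G z b → Adj G z c → a ≢ b → a ≢ c → b ≢ c →
  ¬ Adj G a b → ¬ Adj G a c → ¬ Adj G b c → ⊥

module EdgeClique {n} (G : Graph n) (diamond-free : DiamondFree G) (z : Fin n) where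

  InQ : Fin n → Fin n → Set
  InQ a w = w ≡ z ⊎ w ≡ a ⊎ (Adj G z w × Adj G a w)

  InQ? : ∀ a → Decidable (InQ a)
  InQ? a w = (w ≟ z) ⊎-dec (w ≟ a) ⊎-dec (Adj? G z w ×-dec Adj? G a w)

  Q : Fin n → Subset n
  Q a = ⟦ InQ? a ⟧

  ∈Q⁺ : ∀ {a w} → InQ a w → w ∈ Q a
  ∈Q⁺ {a} = ∈⟦⟧⁺ (InQ? a)

  ∈Q⁻ : ∀ {a w} → w ∈ Q a → InQ a w
  ∈Q⁻ {a} = ∈⟦⟧⁻ (InQ? a)

  Q-clique : ∀ {a} → Adj G z a → IsClique G (Q a)
  Q-clique {a} za u w u∈ w∈ u≢w with ∈Q⁻ u∈ | ∈Q⁻ w∈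
  ... | inj₁ refl | inj₁ refl = ⊥-elim (u≢w refl)
  ... | inj₁ refl | inj₂ (inj₁ refl) = za
  ... | inj₁ refl | inj₂ (inj₂ (zw , _)) = zw
  ... | inj₂ (inj₁ refl) | inj₁ refl = adj-symm G za
  ... | inj₂ (inj₁ refl) | inj₂ (inj₁ refl) = ⊥-elim (u≢w refl)
  ... | inj₂ (inj₁ refl) | inj₂ (inj₂ (_ , aw)) = aw
  ... | inj₂ (inj₂ (zu , _)) | inj₁ refl = adj-symm G zu
  ... | inj₂ (inj₂ (_ , au)) | inj₂ (inj₁ refl) = adj-symm G au
  ... | inj₂ (inj₂ (zu , au)) | inj₂ (inj₂ (zw , aw)) with Adj? G u w
  ...   | yes uw = uw
  ...   | no ¬uw = ⊥-elim (diamond-free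
          (diamond G u≢w ¬uw za (adj-symm G zu) (adj-symm G au) (adj-symm G zw) (adj-symm G aw)))

  Q-maximal : ∀ {a} → Adj G z a → IsMaximalClique G (Q a)
  Q-maximal {a} za = Q-clique za , λ T T-clique Q⊆T {t} t∈T → ∈Q⁺ (member T T-clique Q⊆T t t∈T)
    where
    member : ∀ T → IsClique G T → Q a ⊆ T → ∀ t → t ∈ T → InQ a t
    member T T-clique Q⊆T t t∈T with t ≟ z | t ≟ a
    ... | yes t≡z | _ = inj₁ t≡z
    ... | no _ | yes t≡a = inj₂ (inj₁ t≡a)
    ... | no t≢z | no t≢a = inj₂ (inj₂ (T-clique z t (Q⊆T (∈Q⁺ (inj₁ refl))) t∈T (t≢z ∘ sym) ,
                                          T-clique a t (Q⊆T (∈Q⁺ (inj₂ (inj₁ refl)))) t∈T (t≢a ∘ sym)))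

  Q-excludes : ∀ {a b} → Adj G z a → a ≢ b → ¬ Adj G b a → ¬ (a ∈ Q b)
  Q-excludes za a≢b ¬ba a∈ with ∈Q⁻ a∈
  ... | inj₁ a≡z = adj⇒≢ G za (sym a≡z)
  ... | inj₂ (inj₁ a≡b) = a≢b a≡b
  ... | inj₂ (inj₂ (_ , ba)) = ¬ba ba

-- If K(G) is a forest and G is diamond-free, then G is claw-free: the
-- maximal cliques Q(a), Q(b), Q(c) of the three edges of a claw are distinct
-- and pairwise share the centre, a triangle in K(G).
forest⇒claw-free : ∀ {n} (G : Graph n) → DiamondFree G → CliqueGraphIsForest G → ClawFree G
forest⇒claw-free G diamond-free forest z a b c za zb zc a≢b a≢c b≢c ¬ab ¬ac ¬bc =
  forest (0 , f , f-maximal , f-injective , steps , last)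
  where
  open EdgeClique G diamond-free z
  f : Fin 3 → Subset _
  f fzero = Q a
  f (fsuc fzero) = Q b
  f (fsuc (fsuc fzero)) = Q c
  f-maximal : ∀ t → IsMaximalClique G (f t)
  f-maximal fzero = Q-maximal za
  f-maximal (fsuc fzero) = Q-maximal zb
  f-maximal (fsuc (fsuc fzero)) = Q-maximal zc
  Qa≢Qb : Q a ≢ Q b
  Qa≢Qb e = Q-excludes za a≢b (¬ab ∘ adj-symm G) (subst (a ∈_) e (∈Q⁺ (inj₂ (inj₁ refl))))
  Qa≢Qc : Q a ≢ Q c
  Qa≢Qc e = Q-excludes za a≢c (¬ac ∘ adj-symm G) (subst (a ∈_) e (∈Q⁺ (inj₂ (inj₁ refl))))
  Qb≢Qc : Q b ≢ Q c
  Qb≢Qc e = Q-excludes zb b≢c (¬bc ∘ adj-symm G) (subst (b ∈_) e (∈Q⁺ (inj₂ (inj₁ refl))))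
  f-injective : Injective _≡_ _≡_ f
  f-injective {fzero} {fzero} _ = refl
  f-injective {fzero} {fsuc fzero} e = ⊥-elim (Qa≢Qb e)
  f-injective {fzero} {fsuc (fsuc fzero)} e = ⊥-elim (Qa≢Qc e)
  f-injective {fsuc fzero} {fzero} e = ⊥-elim (Qa≢Qb (sym e))
  f-injective {fsuc fzero} {fsuc fzero} _ = refl
  f-injective {fsuc fzero} {fsuc (fsuc fzero)} e = ⊥-elim (Qb≢Qc e)
  f-injective {fsuc (fsuc fzero)} {fzero} e = ⊥-elim (Qa≢Qc (sym e))
  f-injective {fsuc (fsuc fzero)} {fsuc fzero} e = ⊥-elim (Qb≢Qc (sym e))
  f-injective {fsuc (fsuc fzero)} {fsuc (fsuc fzero)} _ = refl
  share-z : ∀ {x y} → z ∈ Q x ∩ Q y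
  share-z = x∈p∩q⁺ (∈Q⁺ (inj₁ refl) , ∈Q⁺ (inj₁ refl))
  steps : ∀ (t : Fin 2) → KAdj (f (inject₁ t)) (f (fsuc t))
  steps fzero = Qa≢Qb , z , share-z
  steps (fsuc fzero) = Qb≢Qc , z , share-z
  last : KAdj (f (fsuc (fsuc fzero))) (f fzero)
  last = Qa≢Qc ∘ sym , z , share-z

isolate : ∀ {n} → Graph n → Fin n → Graph n
isolate {n} G v = record
  { adj = λ a b → adj G a b ∧ (away a ∧ away b)
  ; sym = λ a b → cong₂ _∧_ (adj-sym G a b) (∧-comm (away a) (away b))
  ; irrefl = λ a → cong (_∧ (away a ∧ away a)) (irrefl G a)
  }
  where
  away : Fin n → Bool
  away a = not (does (a ≟ v))

module Isolate {n} (G : Graph n) (v : Fin n) where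

  G′ : Graph n
  G′ = isolate G v

  away≡true : ∀ {a} → a ≢ v → not (does (a ≟ v)) ≡ true
  away≡true a≢v = cong not (dec-false (_ ≟ v) a≢v)

  down : ∀ {a b} → Adj G′ a b → Adj G a b × a ≢ v × b ≢ v
  down {a} {b} h with adj G a b | a ≟ v | b ≟ v | h
  ... | true | no a≢v | no b≢v | _ = refl , a≢v , b≢v

  up : ∀ {a b} → Adj G a b → a ≢ v → b ≢ v → Adj G′ a b
  up {a} {b} h a≢v b≢v rewrite h | away≡true a≢v | away≡true b≢v = refl

  agree : ∀ {a b} → a ≢ v → b ≢ v → adj G′ a b ≡ adj G a b
  agree {a} {b} a≢v b≢v rewrite away≡true a≢v | away≡true b≢v = ∧-identityʳ (adj G a b)

  ≢v : ∀ {a b} → Adj G′ a b → a ≢ v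
  ≢v h = proj₁ (proj₂ (down h))

  diamond-free : DiamondFree G → DiamondFree G′
  diamond-free df (f , f-injective , f-adj) =
    df (f , f-injective , λ a b → trans (sym (agree (off a) (off b))) (f-adj a b))
    where
    -- every vertex of a diamond has a neighbour in it, so none of them is v
    partner : Fin 4 → Fin 4
    partner fzero = fsuc (fsuc fzero)
    partner (fsuc fzero) = fsuc (fsuc fzero)
    partner (fsuc (fsuc _)) = fzero
    partner-adj : ∀ a → diamondAdj a (partner a) ≡ true
    partner-adj fzero = refl
    partner-adj (fsuc fzero) = refl
    partner-adj (fsuc (fsuc fzero)) = refl
    partner-adj (fsuc (fsuc (fsuc fzero))) = refl
    off : ∀ a → f a ≢ v
    off a = ≢v (trans (f-adj a (partner a)) (partner-adj a))

  chordal : Chordal G → Chordal G′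
  chordal ch (m , c , c-injective , c-adj) = ch (m , c , c-injective , λ a b → mk⇔
      (λ h → Equivalence.to (c-adj a b) (up h (off a) (off b)))
      (λ h → proj₁ (down (Equivalence.from (c-adj a b) h))))
    where
    -- every vertex of a hole has a neighbour on it, so none of them is v
    neighbour : ∀ (a : Fin (4 + m)) → ∃ λ b → CycAdj (4 + m) (toℕ a) (toℕ b)
    neighbour fzero = fsuc fzero , inj₁ refl
    neighbour (fsuc a) = inject₁ a , inj₂ (inj₁ (cong suc (toℕ-inject₁ a)))
    off : ∀ a → c a ≢ v
    off a = ≢v (Equivalence.from (c-adj a (proj₁ (neighbour a))) (proj₂ (neighbour a)))

  clique-number : ∀ {k} → CliqueNumberAtMost G k → CliqueNumberAtMost G′ k
  clique-number ω≤k S clique = ω≤k S (λ u w u∈ w∈ u≢w → proj₁ (down (clique u w u∈ w∈ u≢w)))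

  claw-free : ClawFree G → ClawFree G′
  claw-free cf z a b c za zb zc a≢b a≢c b≢c ¬ab ¬ac ¬bc =
    cf z a b c (proj₁ (down za)) (proj₁ (down zb)) (proj₁ (down zc)) a≢b a≢c b≢c
      (¬ab ∘ λ h → up h a≢v b≢v) (¬ac ∘ λ h → up h a≢v c≢v) (¬bc ∘ λ h → up h b≢v c≢v)
    where
    a≢v : a ≢ v
    a≢v = proj₂ (proj₂ (down za))
    b≢v : b ≢ v
    b≢v = proj₂ (proj₂ (down zb))
    c≢v : c ≢ v
    c≢v = proj₂ (proj₂ (down zc))

HasNeighbour? : ∀ {n} (G : Graph n) u → Dec (∃ (Adj G u))
HasNeighbour? G u = any? (Adj? G u)

nonIsolated : ∀ {n} → Graph n → Subset n
nonIsolated G = ⟦ HasNeighbour? G ⟧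

isolate-shrinks : ∀ {n} (G : Graph n) {v u} → Adj G v u → ∣ nonIsolated (isolate G v) ∣ < ∣ nonIsolated G ∣
isolate-shrinks G {v} {u} vu = p⊂q⇒∣p∣<∣q∣ (sub , v , ∈⟦⟧⁺ (HasNeighbour? G) (u , vu) , v∉)
  where
  open Isolate G v
  sub : nonIsolated G′ ⊆ nonIsolated G
  sub a∈ with ∈⟦⟧⁻ (HasNeighbour? G′) a∈
  ... | w , aw = ∈⟦⟧⁺ (HasNeighbour? G) (w , proj₁ (down aw))
  v∉ : ¬ (v ∈ nonIsolated G′)
  v∉ v∈ with ∈⟦⟧⁻ (HasNeighbour? G′) v∈
  ... | w , vw = ≢v vw refl

module AddArc {n} (D′ : Digraph n) (s t : Fin n) (s≢t : s ≢ t) where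

  D : Digraph n
  D = record { arc = λ a b → arc D′ a b ∨ (does (a ≟ s) ∧ does (b ≟ t)) ; noLoop = no-loop }
    where
    no-loop : ∀ a → arc D′ a a ∨ (does (a ≟ s) ∧ does (a ≟ t)) ≡ false
    no-loop a rewrite noLoop D′ a with a ≟ s
    ... | yes refl rewrite dec-false (s ≟ t) s≢t = refl
    ... | no _ = refl

  arc-old : ∀ {a b} → Arc D′ a b → Arc D a b
  arc-old h rewrite h = refl

  arc-new : Arc D s t
  arc-new rewrite dec-true (s ≟ s) refl | dec-true (t ≟ t) refl = ∨-zeroʳ (arc D′ s t)

  arc-cases : ∀ {a b} → Arc D a b → Arc D′ a b ⊎ (a ≡ s × b ≡ t)
  arc-cases {a} {b} h with arc D′ a b | a ≟ s | b ≟ t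
  ... | true | _ | _ = inj₁ refl
  ... | false | yes a≡s | yes b≡t = inj₂ (a≡s , b≡t)

  arc-off-s : ∀ {a b} → a ≢ s → arc D a b ≡ arc D′ a b
  arc-off-s {a} {b} a≢s rewrite dec-false (a ≟ s) a≢s = ∨-identityʳ (arc D′ a b)

  arc-off-t : ∀ {a b} → b ≢ t → arc D a b ≡ arc D′ a b
  arc-off-t {a} {b} b≢t rewrite dec-false (b ≟ t) b≢t | ∧-zeroʳ (does (a ≟ s)) = ∨-identityʳ (arc D′ a b)

  outdeg-off-s : ∀ {a} → a ≢ s → outdeg D a ≡ outdeg D′ a
  outdeg-off-s {a} a≢s = cong ∣_∣ (tabulate-cong (λ b → arc-off-s {a} {b} a≢s))

  indeg-off-t : ∀ {b} → b ≢ t → indeg D b ≡ indeg D′ b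
  indeg-off-t {b} b≢t = cong ∣_∣ (tabulate-cong (λ a → arc-off-t {a} {b} b≢t))

  outdeg-s : (∀ b → ¬ Arc D′ s b) → outdeg D s ≤ 1
  outdeg-s none = begin
    outdeg D s ≤⟨ p⊆q⇒∣p∣≤∣q∣ only-t ⟩
    ∣ ⁅ t ⁆ ∣  ≡⟨ ∣⁅x⁆∣≡1 t ⟩
    1          ∎
    where
    open ≤-Reasoning
    only-t : tabulate (arc D s) ⊆ ⁅ t ⁆
    only-t b∈ with arc-cases (∈tabulate⁻ (arc D s) b∈)
    ... | inj₁ old = ⊥-elim (none _ old)
    ... | inj₂ (_ , refl) = x∈⁅x⁆ t

  indeg-t : indeg D t ≤ suc (indeg D′ t)
  indeg-t = begin
    indeg D t
      ≡⟨ ∣tabulate∣≡count (λ a → arc D a t) ⟩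
    count (λ a → arc D′ a t ∨ (does (a ≟ s) ∧ does (t ≟ t)))
      ≤⟨ count-∨-point≤ (λ a → arc D′ a t) s (λ _ → does (t ≟ t)) ⟩
    suc (count (λ a → arc D′ a t))
      ≡⟨ cong suc (sym (∣tabulate∣≡count (λ a → arc D′ a t))) ⟩
    suc (indeg D′ t) ∎
    where open ≤-Reasoning

  -- A new cycle would have to pass through s and t; this is impossible when
  -- s had no in-neighbour, or when t had no out-neighbour.
  acyclic-from-source : Acyclic D′ → (∀ a → ¬ Arc D′ a s) → Acyclic D
  acyclic-from-source acyclic′ no-in a cycle = acyclic′ a (old-walk cycle (not-into-s cycle))
    where
    no-in-D : ∀ {a} → ¬ Arc D a s
    no-in-D h with arc-cases h
    ... | inj₁ old = no-in _ old
    ... | inj₂ (_ , s≡t) = s≢t s≡t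
    not-into-s : ∀ {a b} → Reach D a b → b ≢ s
    not-into-s (step h) refl = no-in-D h
    not-into-s (_ ∷ r) = not-into-s r
    old-walk : ∀ {a b} → Reach D a b → a ≢ s → Reach D′ a b
    old-walk (step h) a≢s = step (trans (sym (arc-off-s a≢s)) h)
    old-walk (h ∷ r) a≢s = trans (sym (arc-off-s a≢s)) h ∷ old-walk r (λ { refl → no-in-D h })

  acyclic-into-sink : Acyclic D′ → (∀ b → ¬ Arc D′ t b) → Acyclic D
  acyclic-into-sink acyclic′ no-out a cycle = acyclic′ a (old-walk cycle (not-from-t cycle))
    where
    no-out-D : ∀ {b} → ¬ Arc D t b
    no-out-D h with arc-cases h
    ... | inj₁ old = no-out _ old
    ... | inj₂ (t≡s , _) = s≢t (sym t≡s)
    not-from-t : ∀ {a b} → Reach D a b → a ≢ t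
    not-from-t (step h) refl = no-out-D h
    not-from-t (h ∷ _) refl = no-out-D h
    old-walk : ∀ {a b} → Reach D a b → b ≢ t → Reach D′ a b
    old-walk (step h) b≢t = step (trans (sym (arc-off-t b≢t)) h)
    old-walk (h ∷ r) b≢t = trans (sym (arc-off-t (not-from-t r))) h ∷ old-walk r b≢t

  PAdj-old : ∀ {a b} → PAdj D′ a b → PAdj D a b
  PAdj-old (a≢b , inj₁ h) = a≢b , inj₁ (arc-old h)
  PAdj-old (a≢b , inj₂ (inj₁ h)) = a≢b , inj₂ (inj₁ (arc-old h))
  PAdj-old (a≢b , inj₂ (inj₂ (w , h , g))) = a≢b , inj₂ (inj₂ (w , arc-old h , arc-old g))

  PAdj-off-s : ∀ {a b} → a ≢ s → b ≢ s → PAdj D a b → PAdj D′ a b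
  PAdj-off-s a≢s b≢s (a≢b , inj₁ h) = a≢b , inj₁ (trans (sym (arc-off-s a≢s)) h)
  PAdj-off-s a≢s b≢s (a≢b , inj₂ (inj₁ h)) = a≢b , inj₂ (inj₁ (trans (sym (arc-off-s b≢s)) h))
  PAdj-off-s a≢s b≢s (a≢b , inj₂ (inj₂ (w , h , g))) =
    a≢b , inj₂ (inj₂ (w , trans (sym (arc-off-s a≢s)) h , trans (sym (arc-off-s b≢s)) g))

  PAdj-off-t : (∀ a → ¬ Arc D′ a t) → ∀ {a b} → a ≢ t → b ≢ t → PAdj D a b → PAdj D′ a b
  PAdj-off-t _ a≢t b≢t (a≢b , inj₁ h) = a≢b , inj₁ (trans (sym (arc-off-t b≢t)) h)
  PAdj-off-t _ a≢t b≢t (a≢b , inj₂ (inj₁ h)) = a≢b , inj₂ (inj₁ (trans (sym (arc-off-t a≢t)) h))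
  PAdj-off-t no-in {a} {b} _ _ (a≢b , inj₂ (inj₂ (w , h , g))) = common-out (w ≟ t) h g
    where
    -- a common out-neighbour other than t is old; t has only the in-neighbour s
    common-out : ∀ {w} → Dec (w ≡ t) → Arc D a w → Arc D b w → PAdj D′ a b
    common-out {w} (no w≢t) h g =
      a≢b , inj₂ (inj₂ (w , trans (sym (arc-off-t w≢t)) h , trans (sym (arc-off-t w≢t)) g))
    common-out (yes refl) h g with arc-cases h | arc-cases g
    ... | inj₁ old | _ = ⊥-elim (no-in a old)
    ... | inj₂ _ | inj₁ old = ⊥-elim (no-in b old)
    ... | inj₂ (a≡s , _) | inj₂ (b≡s , _) = ⊥-elim (a≢b (trans a≡s (sym b≡s)))

Realisation : ℕ → ∀ {n} → Graph n → Set
Realisation i {n} G = Σ (Digraph n) λ D → IJDigraph i 1 D × (∀ u v → Adj G u v ⇔ PAdj D u v)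

agree-around : ∀ {n} (G : Graph n) (D : Digraph n) (v : Fin n) →
  (∀ {a b} → a ≢ v → b ≢ v → Adj G a b ⇔ PAdj D a b) →
  (∀ {b} → b ≢ v → Adj G v b ⇔ PAdj D v b) →
  ∀ a b → Adj G a b ⇔ PAdj D a b
agree-around G D v away at a b with a ≟ v | b ≟ v
... | yes refl | yes refl = mk⇔ (λ h → ⊥-elim (adj⇒≢ G h refl)) (λ p → ⊥-elim (proj₁ p refl))
... | yes refl | no b≢v = at b≢v
... | no a≢v | yes refl = mk⇔ (PAdj-sym D ∘ Equivalence.to (at a≢v) ∘ adj-symm G)
                              (adj-symm G ∘ Equivalence.from (at a≢v) ∘ PAdj-sym D)
... | no a≢v | no b≢v = away a≢v b≢v

-- Let v be a simplicial vertex of G with a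
-- neighbour u₀, and let D′ realise G with v isolated.  Then adding a single
-- arc at v realises G: either N(v) is a family F(z) of D′, and v becomes an
-- in-neighbour of z, or N(v) = {x} for a vertex x without out-neighbour, which
-- becomes the in-neighbour of v.  (If x has both an in- and an out-neighbour,
-- those two together with v form a claw at x.)
module Extension (i : ℕ) (1≤i : 1 ≤ i) {n} (G : Graph n)
  (diamond-free : DiamondFree G) (claw-free : ClawFree G) (ω≤1+i : CliqueNumberAtMost G (suc i))
  (v : Fin n) (simplicial : Simplicial G v) {u₀ : Fin n} (vu₀ : Adj G v u₀)
  (D′ : Digraph n) (acyclic′ : Acyclic D′)
  (indeg′≤i : ∀ w → indeg D′ w ≤ i) (outdeg′≤1 : ∀ w → outdeg D′ w ≤ 1)
  (realises′ : ∀ a b → Adj (isolate G v) a b ⇔ PAdj D′ a b) where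

  open Isolate G v using (up; down)
  functional′ : ∀ {u w w′} → Arc D′ u w → Arc D′ u w′ → w ≡ w′
  functional′ = outdeg≤1⇒functional D′ outdeg′≤1
  open Families D′ acyclic′ functional′

  toG : ∀ {a b} → PAdj D′ a b → Adj G a b × a ≢ v × b ≢ v
  toG {a} {b} p = down (Equivalence.from (realises′ a b) p)

  fromG : ∀ {a b} → Adj G a b → a ≢ v → b ≢ v → PAdj D′ a b
  fromG {a} {b} h a≢v b≢v = Equivalence.to (realises′ a b) (up h a≢v b≢v)

  away′ : ∀ {a b} → a ≢ v → b ≢ v → Adj G a b ⇔ PAdj D′ a b
  away′ a≢v b≢v = mk⇔ (λ h → fromG h a≢v b≢v) (proj₁ ∘ toG)

  nbr≢v : ∀ {u} → Adj G v u → u ≢ v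
  nbr≢v h = adj⇒≢ G h ∘ sym

  no-in : ∀ a → ¬ Arc D′ a v
  no-in a h = proj₂ (proj₂ (toG (arc⇒≢ D′ h , inj₁ h))) refl

  no-out : ∀ b → ¬ Arc D′ v b
  no-out b h = proj₁ (proj₂ (toG (arc⇒≢ D′ h , inj₁ h))) refl

  -- The closed neighbourhood of the simplicial vertex v is a clique, so v has
  -- at most i neighbours.
  degree≤i : count (adj G v) ≤ i
  degree≤i = ≤-pred (begin
    suc (count (adj G v))
      ≡⟨ sym (count-insert (adj G v) v (irrefl G v)) ⟩
    count (λ u → does (u ≟ v) ∨ adj G v u)
      ≡⟨ count-cong (λ u → cong (does (u ≟ v) ∨_) (sym (does-≟true (adj G v u)))) ⟩
    count (λ u → does (Closed? u))
      ≡⟨ sym (∣tabulate∣≡count (λ u → does (Closed? u))) ⟩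
    ∣ ⟦ Closed? ⟧ ∣
      ≤⟨ ω≤1+i ⟦ Closed? ⟧ closed-clique ⟩
    suc i ∎)
    where
    open ≤-Reasoning
    Closed? : ∀ u → Dec (u ≡ v ⊎ Adj G v u)
    Closed? u = (u ≟ v) ⊎-dec Adj? G v u
    closed-clique : IsClique G ⟦ Closed? ⟧
    closed-clique a b a∈ b∈ a≢b with ∈⟦⟧⁻ Closed? a∈ | ∈⟦⟧⁻ Closed? b∈
    ... | inj₁ refl | inj₁ refl = ⊥-elim (a≢b refl)
    ... | inj₁ refl | inj₂ vb = vb
    ... | inj₂ va | inj₁ refl = adj-symm G va
    ... | inj₂ va | inj₂ vb = simplicial a b va vb a≢b

  hang : (z : Fin n) → z ≢ v → (∀ u → u ≢ v → Adj G v u ⇔ InFamily z u) → Realisation i G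
  hang z z≢v N≡F =
    D , (acyclic-from-source acyclic′ no-in , indeg≤i , outdeg≤1) , agree-around G D v away at
    where
    open AddArc D′ v z (z≢v ∘ sym)
    v∉F : ¬ InFamily z v
    v∉F (inj₁ v≡z) = z≢v (sym v≡z)
    v∉F (inj₂ h) = no-out z h
    -- |F(z)| ≤ deg v, so z can take one more in-neighbour
    room : suc (indeg D′ z) ≤ i
    room = begin
      suc (indeg D′ z)                     ≡⟨ sym (family-size z) ⟩
      count (λ u → does (InFamily? z u))   ≤⟨ count-mono _ (adj G v) member ⟩
      count (adj G v)                      ≤⟨ degree≤i ⟩
      i                                    ∎
      where
      open ≤-Reasoning
      member : ∀ u → does (InFamily? z u) ≡ true → adj G v u ≡ true
      member u does-u = Equivalence.from (N≡F u (λ { refl → v∉F u∈F })) u∈F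
        where
        u∈F : InFamily z u
        u∈F = from-does (InFamily? z u) does-u
    indeg≤i : ∀ w → indeg D w ≤ i
    indeg≤i = by-cases z (≤-trans indeg-t room)
                         (λ w w≢z → subst (_≤ i) (sym (indeg-off-t w≢z)) (indeg′≤i w))
    outdeg≤1 : ∀ w → outdeg D w ≤ 1
    outdeg≤1 = by-cases v (outdeg-s no-out) (λ w w≢v → subst (_≤ 1) (sym (outdeg-off-s w≢v)) (outdeg′≤1 w))
    away : ∀ {a b} → a ≢ v → b ≢ v → Adj G a b ⇔ PAdj D a b
    away a≢v b≢v = mk⇔ (PAdj-old ∘ Equivalence.to (away′ a≢v b≢v))
                       (Equivalence.from (away′ a≢v b≢v) ∘ PAdj-off-s a≢v b≢v)
    family⇒PAdj : ∀ {b} → b ≢ v → InFamily z b → PAdj D v b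
    family⇒PAdj b≢v (inj₁ refl) = b≢v ∘ sym , inj₁ arc-new
    family⇒PAdj b≢v (inj₂ h) = b≢v ∘ sym , inj₂ (inj₂ (z , arc-new , arc-old h))
    PAdj⇒family : ∀ {b} → b ≢ v → PAdj D v b → InFamily z b
    PAdj⇒family _ (_ , inj₁ h) with arc-cases h
    ... | inj₁ old = ⊥-elim (no-out _ old)
    ... | inj₂ (_ , b≡z) = inj₁ b≡z
    PAdj⇒family b≢v (_ , inj₂ (inj₁ h)) with arc-cases h
    ... | inj₁ old = ⊥-elim (no-in _ old)
    ... | inj₂ (b≡v , _) = ⊥-elim (b≢v b≡v)
    PAdj⇒family b≢v (_ , inj₂ (inj₂ (w , h , g))) with arc-cases h
    ... | inj₁ old = ⊥-elim (no-out _ old)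
    ... | inj₂ (_ , refl) = inj₂ (trans (sym (arc-off-s b≢v)) g)
    at : ∀ {b} → b ≢ v → Adj G v b ⇔ PAdj D v b
    at {b} b≢v = mk⇔ (family⇒PAdj b≢v ∘ Equivalence.to (N≡F b b≢v))
                     (Equivalence.from (N≡F b b≢v) ∘ PAdj⇒family b≢v)

  attach : (x : Fin n) → x ≢ v → (∀ u → Adj G v u ⇔ u ≡ x) → (∀ b → ¬ Arc D′ x b) → Realisation i G
  attach x x≢v N≡x x-sink =
    D , (acyclic-into-sink acyclic′ no-out , indeg≤i , outdeg≤1) , agree-around G D v away at
    where
    open AddArc D′ x v x≢v
    indeg′v≡0 : indeg D′ v ≡ 0
    indeg′v≡0 =
      trans (∣tabulate∣≡count (λ a → arc D′ a v)) (count-zero (λ a → arc D′ a v) (λ a → ¬-not (no-in a)))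
    indeg≤i : ∀ w → indeg D w ≤ i
    indeg≤i = by-cases v (≤-trans indeg-t (subst (λ d → suc d ≤ i) (sym indeg′v≡0) 1≤i))
                         (λ w w≢v → subst (_≤ i) (sym (indeg-off-t w≢v)) (indeg′≤i w))
    outdeg≤1 : ∀ w → outdeg D w ≤ 1
    outdeg≤1 = by-cases x (outdeg-s x-sink) (λ w w≢x → subst (_≤ 1) (sym (outdeg-off-s w≢x)) (outdeg′≤1 w))
    away : ∀ {a b} → a ≢ v → b ≢ v → Adj G a b ⇔ PAdj D a b
    away a≢v b≢v = mk⇔ (PAdj-old ∘ Equivalence.to (away′ a≢v b≢v))
                       (Equivalence.from (away′ a≢v b≢v) ∘ PAdj-off-t no-in a≢v b≢v)
    PAdj⇒x : ∀ {b} → PAdj D v b → b ≡ x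
    PAdj⇒x (_ , inj₁ h) with arc-cases h
    ... | inj₁ old = ⊥-elim (no-out _ old)
    ... | inj₂ (v≡x , _) = ⊥-elim (x≢v (sym v≡x))
    PAdj⇒x (_ , inj₂ (inj₁ h)) with arc-cases h
    ... | inj₁ old = ⊥-elim (no-in _ old)
    ... | inj₂ (b≡x , _) = b≡x
    PAdj⇒x (_ , inj₂ (inj₂ (w , h , _))) with arc-cases h
    ... | inj₁ old = ⊥-elim (no-out _ old)
    ... | inj₂ (v≡x , _) = ⊥-elim (x≢v (sym v≡x))
    at : ∀ {b} → b ≢ v → Adj G v b ⇔ PAdj D v b
    at {b} b≢v = mk⇔ (λ vb → subst (PAdj D v) (sym (Equivalence.to (N≡x b) vb))
                                   (x≢v ∘ sym , inj₂ (inj₁ arc-new)))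
                     (Equivalence.from (N≡x b) ∘ PAdj⇒x)

  -- v has a second neighbour y: N(v) is a clique of P(D′), hence lies in the
  -- family F(z) of u₀ and y; conversely every u ∈ F(z) is a neighbour of v,
  -- for otherwise v, u would be the apexes of a diamond on the edge u₀y.
  two-neighbours : ∀ {y} → Adj G v y → y ≢ u₀ → Realisation i G
  two-neighbours {y} vy y≢u₀ = hang z z≢v (λ u u≢v → mk⇔ (N⊆F u) (F⊆N u u≢v))
    where
    N-clique : ∀ a b → Adj G v a → Adj G v b → a ≢ b → PAdj D′ a b
    N-clique a b va vb a≢b = fromG (simplicial a b va vb a≢b) (nbr≢v va) (nbr≢v vb)
    z : Fin n
    z = familyOf u₀ y
    N⊆F : ∀ u → Adj G v u → InFamily z u
    N⊆F = clique⇒family (Adj G v) N-clique vu₀ vy (y≢u₀ ∘ sym)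
    F⊆N : ∀ u → u ≢ v → InFamily z u → Adj G v u
    F⊆N u u≢v u∈F with Adj? G v u
    ... | yes vu = vu
    ... | no ¬vu = ⊥-elim (diamond-free (diamond G (u≢v ∘ sym) ¬vu (simplicial u₀ y vu₀ vy (y≢u₀ ∘ sym))
                     vu₀ vy (adj-to u₀ vu₀) (adj-to y vy)))
      where
      adj-to : ∀ x → Adj G v x → Adj G u x
      adj-to x vx = proj₁ (toG (family⇒padj u∈F (N⊆F x vx) λ { refl → ¬vu vx }))
    z≢v : z ≢ v
    z≢v z≡v with N⊆F u₀ vu₀
    ... | inj₁ u₀≡z = nbr≢v vu₀ (trans u₀≡z z≡v)
    ... | inj₂ h = no-in u₀ (subst (Arc D′ u₀) z≡v h)

  -- x, its in-neighbour c and its out-neighbour q: v, q, c would be a claw at x.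
  claw : ∀ {x c q} → (∀ u → Adj G v u ⇔ u ≡ x) → Arc D′ c x → Arc D′ x q → ⊥
  claw {x} {c} {q} N≡x cx xq =
    claw-free x v q c (adj-symm G vx) (proj₁ (toG (arc⇒≢ D′ xq , inj₁ xq)))
      (proj₁ (toG (arc⇒≢ D′ cx ∘ sym , inj₂ (inj₁ cx)))) v≢q v≢c q≢c ¬vq ¬vc ¬qc
    where
    vx : Adj G v x
    vx = Equivalence.from (N≡x x) refl
    v≢q : v ≢ q
    v≢q refl = no-in x xq
    v≢c : v ≢ c
    v≢c refl = no-out x cx
    q≢c : q ≢ c
    q≢c refl = no-2-cycle xq cx
    ¬vq : ¬ Adj G v q
    ¬vq vq = arc⇒≢ D′ xq (sym (Equivalence.to (N≡x q) vq))
    ¬vc : ¬ Adj G v c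
    ¬vc vc = arc⇒≢ D′ cx (Equivalence.to (N≡x c) vc)
    ¬qc : ¬ Adj G q c
    ¬qc qc with fromG qc (v≢q ∘ sym) (v≢c ∘ sym)
    ... | _ , inj₁ qc′ = acyclic′ c (cx ∷ (xq ∷ step qc′))
    ... | _ , inj₂ (inj₁ cq) = arc⇒≢ D′ xq (functional′ cx cq)
    ... | _ , inj₂ (inj₂ (w , qw , cw)) = no-2-cycle xq (subst (Arc D′ q) (sym (functional′ cx cw)) qw)

  one-neighbour : (∀ u → Adj G v u ⇔ u ≡ u₀) → Realisation i G
  one-neighbour N≡u₀ with any? (λ c → Arc? D′ c u₀) | any? (λ q → Arc? D′ u₀ q)
  ... | no no-in-u₀ | _ = hang u₀ (nbr≢v vu₀) (λ u _ → mk⇔ (inj₁ ∘ Equivalence.to (N≡u₀ u)) (into-u₀ u))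
    where
    into-u₀ : ∀ u → InFamily u₀ u → Adj G v u
    into-u₀ u (inj₁ refl) = vu₀
    into-u₀ u (inj₂ h) = ⊥-elim (no-in-u₀ (u , h))
  ... | yes _ | no u₀-sink = attach u₀ (nbr≢v vu₀) N≡u₀ (λ b h → u₀-sink (b , h))
  ... | yes (c , cu₀) | yes (q , u₀q) = ⊥-elim (claw N≡u₀ cu₀ u₀q)

  realisation : Realisation i G
  realisation with any? (λ y → Adj? G v y ×-dec ¬? (y ≟ u₀))
  ... | yes (y , vy , y≢u₀) = two-neighbours vy y≢u₀
  ... | no none = one-neighbour λ u →
    mk⇔ (λ vu → decidable-stable (u ≟ u₀) (λ u≢u₀ → none (u , vu , u≢u₀))) (λ { refl → vu₀ })

edgeless-realisation : ∀ i {n} (G : Graph n) → (∀ a b → ¬ Adj G a b) → Realisation i G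
edgeless-realisation i {n} G edgeless =
  D , (acyclic , (λ _ → ≤-trans (≤-reflexive no-arcs) z≤n) , (λ _ → ≤-trans (≤-reflexive no-arcs) z≤n)) ,
  λ a b → mk⇔ (⊥-elim ∘ edgeless a b) (⊥-elim ∘ no-padj)
  where
  D : Digraph n
  D = record { arc = λ _ _ → false ; noLoop = λ _ → refl }
  acyclic : Acyclic D
  acyclic v (step ())
  acyclic v (() ∷ _)
  no-arcs : ∣ tabulate {n = n} (λ _ → false) ∣ ≡ 0
  no-arcs = trans (∣tabulate∣≡count {n} (λ _ → false)) (count-zero {n} (λ _ → false) (λ _ → refl))
  no-padj : ∀ {a b} → ¬ PAdj D a b
  no-padj (_ , inj₁ ())
  no-padj (_ , inj₂ (inj₁ ()))
  no-padj (_ , inj₂ (inj₂ (_ , () , _)))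

realise : ∀ i → 1 ≤ i → ∀ k {n} (G : Graph n) → ∣ nonIsolated G ∣ ≤ k →
  DiamondFree G → Chordal G → CliqueNumberAtMost G (suc i) → ClawFree G → Realisation i G
realise i 1≤i k G size≤k df ch ω cf with any? (HasNeighbour? G)
... | no edgeless = edgeless-realisation i G (λ a b ab → edgeless (a , b , ab))
... | yes (a , b , ab) with simplicial-vertex G df ch ab
...   | v , simplicial , u , vu = smaller k size≤k
  where
  open Isolate G v using (G′)
  smaller : ∀ k → ∣ nonIsolated G ∣ ≤ k → Realisation i G
  smaller zero size≤0 = ⊥-elim (≤⇒≯ size≤0 (≤-trans (s≤s z≤n) (isolate-shrinks G vu)))
  smaller (suc k′) size≤k with realise i 1≤i k′ G′ (≤-pred (≤-trans (isolate-shrinks G vu) size≤k))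
           (Isolate.diamond-free G v df) (Isolate.chordal G v ch)
           (Isolate.clique-number G v ω) (Isolate.claw-free G v cf)
  ... | D′ , (acyclic′ , indeg′≤i , outdeg′≤1) , realises′ =
    Extension.realisation i 1≤i G df cf ω v simplicial vu D′ acyclic′ indeg′≤i outdeg′≤1 realises′

theorem2p8 : ∀ (i : ℕ) → 1 ≤ i → ∀ {n} (G : Graph n) →
    IsPhylogenyGraph i 1 G ⇔
      (DiamondFree G × Chordal G × CliqueNumberAtMost G (suc i) × CliqueGraphIsForest G)
theorem2p8 i 1≤i G = mk⇔ necessity sufficiency
  where
  necessity : IsPhylogenyGraph i 1 G →
    DiamondFree G × Chordal G × CliqueNumberAtMost G (suc i) × CliqueGraphIsForest G
  necessity (D , (acyclic , indeg≤i , outdeg≤1) , σ , iso) =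
    diamond-free , chordal , clique-number , clique-graph-forest
    where open PhylogenyGraphProperties i G D acyclic indeg≤i outdeg≤1 σ iso
  sufficiency : DiamondFree G × Chordal G × CliqueNumberAtMost G (suc i) × CliqueGraphIsForest G →
    IsPhylogenyGraph i 1 G
  sufficiency (df , ch , ω , forest) with realise i 1≤i _ G ≤-refl df ch ω (forest⇒claw-free G df forest)
  ... | D , ij , realises = D , ij , idₚ , realises
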